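{- For every named $\mathrm{GS4}$ derivation $P$ with conclusion $\vdash\Gamma$ there is a cut-free named $\mathrm{GS4}$ derivation $Q$ with conclusion $\vdash\Gamma$ such that $\langle\!\langle P\rangle\!\rangle=\langle\!\langle Q\rangle\!\rangle$.
   Context: Named formulas and sequents. Fix a countably infinite set $\mathcal N$ of names and a set $\mathcal A$ of atoms with a fixpoint-free involution $\alpha\mapsto\bar\alpha$. Named formulas: $A,B::=\alpha^x\mid A\lor B\mid A\land B$ ($\alpha\in\mathcal A$, $x\in\mathcal N$); formulas $\alpha^x$ are atomic. Negation: $\overline{\alpha^x}=\bar\alpha^x$, $\overline{A\lor B}=\bar A\land\bar B$, $\overline{A\land B}=\bar A\lor\bar B$ (names preserved). $\mathrm{names}(A)$ is the set of names in $A$, $\mathrm{names}(\Gamma)=\bigcup_{A\in\Gamma}\mathrm{names}(A)$. $A\equiv B$ means $A,B$ coincide after erasing names. A formula is sharing-free if each name occurs in it at most once; a set is sharing-free if its members are sharing-free with pairwise disjoint name sets. A sequent $\vdash\Gamma$ is a finite sharing-free set $\Gamma$; in comma notation the components have pairwise disjoint name sets and $\Gamma,A=\Gamma\cup\{A\}$. Derivations. Named $\mathrm{GS4}$ derivations are finite trees of rule applications labelled with sharing-free sequents: axiom $\mathrm{ax}_{\{A,\bar B\}}$ (no premisses, conclusion $\vdash\Gamma,A,\bar B$, $A\equiv B$); cut (premisses $\vdash\Gamma,A$, $\vdash\Gamma,\bar A$, conclusion $\vdash\Gamma$); superposition $\sqcup$ (premisses $\vdash\Gamma$, $\vdash\Gamma$,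 conclusion $\vdash\Gamma$); $\lor$ (premiss $\vdash\Gamma,A,B$, conclusion $\vdash\Gamma,A\lor B$); $\land$ (premisses $\vdash\Gamma,A$, $\vdash\Gamma,B$, conclusion $\vdash\Gamma,A\land B$). Cut-free: no cut rule occurs. Branches. $\mathrm{Br}(\alpha^x)=\{\{x\}\}$, $\mathrm{Br}(B\lor C)=\{X\cup Y\mid X\in\mathrm{Br}(B),Y\in\mathrm{Br}(C)\}$, $\mathrm{Br}(B\land C)=\mathrm{Br}(B)\cup\mathrm{Br}(C)$; for sharing-free $\Gamma$, $\mathrm{Br}(\Gamma)=\{X\subseteq\mathrm{names}(\Gamma)\mid\forall A\in\Gamma,\ X\cap\mathrm{names}(A)\in\mathrm{Br}(A)\}$. Branch-labeled graphs. A bl-graph is $G=\langle V_G,\triangleleft_G\rangle$ with $V_G\subseteq\mathcal N$ and $\triangleleft_G$ a relation between 2-element subsets $e$ of $V_G$ and subsets $X\subseteq V_G$ such that $e\triangleleft_G X$ implies $e\subseteq X$. Union $\sqcup$ is componentwise union; equality is equality of both components. For $I\subseteq\mathcal N$: $e\triangleleft^I_G X$ iff $e\triangleleft_G Y$ for some $Y$ with $X=Y\setminus I$. An alternating $X$-labeled path between bl-graphs $G,H$ through $I$ is a sequence $x_1,\dots,x_n$ ($n>1$) of pairwise distinct vertices of $G$ or $H$ with $x_i\in I$ for $1<i<n$ such that either $x_ix_{i+1}\triangleleft^I_G X$ for all odd $i$ and $x_ix_{i+1}\triangleleft^I_H X$ for all even $i$, or the same with $G,H$ swapped; it is complete if $x_1,x_n\notin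 I$. $G\odot_I H$ has vertex set $V=(V_G\cup V_H)\setminus I$ and, for $x\ne y\in V$, $X\subseteq V$, $xy\triangleleft X$ iff there is a complete alternating $X$-labeled path from $x$ to $y$ between $G$ and $H$ through $I$; $\odot_A=\odot_{\mathrm{names}(A)}$. $\mathrm{wk}_\Gamma(G)=\langle V_G\cup\mathrm{names}(\Gamma),\{(e,X\cup Y)\mid e\triangleleft_G X,\,Y\in\mathrm{Br}(\Gamma)\}\rangle$. $\mathrm{id}_{\{\alpha^x,\bar\alpha^y\}}=\langle\{x,y\},\{(xy,\{x,y\})\}\rangle$, and for disjoint sharing-free $A_1\lor A_2$, $\bar B_1\land\bar B_2$ with $A_i\equiv B_i$, $\mathrm{id}_{\{A_1\lor A_2,\bar B_1\land\bar B_2\}}=\mathrm{wk}_{\{A_2\}}(\mathrm{id}_{\{A_1,\bar B_1\}})\sqcup\mathrm{wk}_{\{A_1\}}(\mathrm{id}_{\{A_2,\bar B_2\}})$ (every axiom pair of non-atomic formulas is an unordered pair of this shape). $\langle\!\langle P\rangle\!\rangle$ is $\mathrm{wk}_\Gamma(\mathrm{id}_{\{A,\bar B\}})$ for an axiom $\mathrm{ax}_{\{A,\bar B\}}$ with conclusion $\vdash\Gamma,A,\bar B$; $\langle\!\langle Q\rangle\!\rangle\odot_A\langle\!\langle R\rangle\!\rangle$ for a cut with premiss derivations $Q$ of $\vdash\Gamma,A$, $R$ of $\vdash\Gamma,\bar A$; the union of the premisses' bl-graphs for $\sqcup,\lor,\land$. -}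

module Defs where

open import Data.Nat using (ℕ)
open import Data.List using (List; []; _∷_; _++_; [_]; concatMap)
open import Data.List.Membership.Propositional using (_∈_)
open import Data.List.Relation.Unary.All using (All)
open import Data.List.Relation.Unary.AllPairs using (AllPairs)
open import Data.List.Relation.Unary.Unique.Propositional using (Unique)
open import Data.Product using (Σ; ∃; _×_; _,_)
open import Data.Sum using (_⊎_)
open import Data.Empty using (⊥)
open import Data.Unit using (⊤)
open import Relation.Nullary using (¬_)
open import Relation.Binary.PropositionalEquality using (_≡_; _≢_)

_⟺_ : Set → Set → Set
P ⟺ Q = (P → Q) × (Q → P)

Name : Set
Name = ℕ

-- Finite sets of names are represented by lists; a list X "denotes" the
-- set described by a predicate P when membership agrees.
_≐_ : List Name → (Name → Set) → Set
X ≐ P = ∀ z → (z ∈ X) ⟺ P z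

Disjoint : List Name → List Name → Set
Disjoint xs ys = ∀ z → z ∈ xs → z ∈ ys → ⊥

-- V is the vertex set; E x y X means {x,y} ◁ X.  All graphs built below
-- have E symmetric in x,y and invariant under set-equality of X, so
-- the pointwise equivalence _≅_ is equality of bl-graphs.

record BLGraph : Set₁ where
  field
    V : Name → Set
    E : Name → Name → List Name → Set
open BLGraph public

_≅_ : BLGraph → BLGraph → Set
G ≅ H = (∀ z → V G z ⟺ V H z) × (∀ x y X → E G x y X ⟺ E H x y X)

_⊔_ : BLGraph → BLGraph → BLGraph
G ⊔ H = record { V = λ z → V G z ⊎ V H z ; E = λ x y X → E G x y X ⊎ E H x y X }

EdgeI : BLGraph → List Name → Name → Name → List Name → Set
EdgeI G I x y X = ∃ λ Y → E G x y Y × (X ≐ λ z → z ∈ Y × ¬ (z ∈ I))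

Alt : BLGraph → BLGraph → List Name → List Name → List Name → Set
Alt G H I X (x ∷ y ∷ []) = EdgeI G I x y X
Alt G H I X (x ∷ y ∷ z ∷ r) = EdgeI G I x y X × Alt H G I X (y ∷ z ∷ r)
Alt G H I X _ = ⊥

-- A complete alternating X-labeled path from x to y between G and H
-- through I: x = x₁, ms = x₂ … x_{n-1}, y = x_n.
CompletePath : BLGraph → BLGraph → List Name → List Name → Name → Name → Set
CompletePath G H I X x y =
  Σ (List Name) λ ms →
    Unique (x ∷ ms ++ y ∷ [])
    × All (λ z → z ∈ I) ms
    × ¬ (x ∈ I) × ¬ (y ∈ I)
    × All (λ z → V G z ⊎ V H z) (x ∷ ms ++ y ∷ [])
    × (Alt G H I X (x ∷ ms ++ y ∷ []) ⊎ Alt H G I X (x ∷ ms ++ y ∷ []))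

_⊙[_]_ : BLGraph → List Name → BLGraph → BLGraph
G ⊙[ I ] H = record { V = W ; E = Ed }
  where
  W : Name → Set
  W z = (V G z ⊎ V H z) × ¬ (z ∈ I)
  Ed : Name → Name → List Name → Set
  Ed x y X = x ≢ y × W x × W y × (∀ z → z ∈ X → W z) × CompletePath G H I X x y

module GS4 (Atom : Set) (bar : Atom → Atom) where

  infixr 6 _∨'_
  infixr 7 _∧'_

  data Formula : Set where
    at    : Atom → Name → Formula
    _∨'_  : Formula → Formula → Formula
    _∧'_  : Formula → Formula → Formula

  neg : Formula → Formula
  neg (at a x) = at (bar a) x
  neg (A ∨' B) = neg A ∧' neg B
  neg (A ∧' B) = neg A ∨' neg B

  -- Name erasure; A ≡ B in the paper is erase A ≡ erase B.
  data Shape : Set where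
    at    : Atom → Shape
    _∨'_  : Shape → Shape → Shape
    _∧'_  : Shape → Shape → Shape

  erase : Formula → Shape
  erase (at a x) = at a
  erase (A ∨' B) = erase A ∨' erase B
  erase (A ∧' B) = erase A ∧' erase B

  -- names as a list with multiplicity (occurrences)
  names : Formula → List Name
  names (at a x) = [ x ]
  names (A ∨' B) = names A ++ names B
  names (A ∧' B) = names A ++ names B

  namesΓ : List Formula → List Name
  namesΓ = concatMap names

  SharingFreeF : Formula → Set
  SharingFreeF A = Unique (names A)

  SharingFree : List Formula → Set
  SharingFree Γ = All SharingFreeF Γ × AllPairs (λ A B → Disjoint (names A) (names B)) Γ

  _≋_ : List Formula → List Formula → Set
  Γ ≋ Δ = ∀ A → (A ∈ Γ) ⟺ (A ∈ Δ)

  InBr : Formula → List Name → Set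
  InBr (at a x) X = X ≐ λ z → z ≡ x
  InBr (B ∨' C) X = ∃ λ Y → ∃ λ Z → InBr B Y × InBr C Z × (X ≐ λ z → z ∈ Y ⊎ z ∈ Z)
  InBr (B ∧' C) X = InBr B X ⊎ InBr C X

  BrΓ : List Formula → List Name → Set
  BrΓ Γ X = (∀ z → z ∈ X → z ∈ namesΓ Γ)
          × All (λ A → ∃ λ Y → InBr A Y × (Y ≐ λ z → z ∈ X × z ∈ names A)) Γ

  wk : List Formula → BLGraph → BLGraph
  wk Γ G = record
    { V = λ z → V G z ⊎ z ∈ namesΓ Γ
    ; E = λ x y Z → ∃ λ X → ∃ λ Y → E G x y X × BrΓ Γ Y × (Z ≐ λ z → z ∈ X ⊎ z ∈ Y) }

  idAt : Name → Name → BLGraph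
  idAt u v = record
    { V = λ z → z ≡ u ⊎ z ≡ v
    ; E = λ x y X → ((x ≡ u × y ≡ v) ⊎ (x ≡ v × y ≡ u)) × (X ≐ λ z → z ≡ u ⊎ z ≡ v) }

  emptyG : BLGraph
  emptyG = record { V = λ _ → ⊥ ; E = λ _ _ _ → ⊥ }

  -- id_{A,C} for an axiom pair {A, C} (C = B̄ with A ≡ B).  The (A∧,C∨)
  -- case is the unordered-pair reading: id_{C1∨C2, A1∧A2}.  Mismatched
  -- shapes never arise from axioms.
  idG : Formula → Formula → BLGraph
  idG (at a x) (at b y) = idAt x y
  idG (A₁ ∨' A₂) (C₁ ∧' C₂) = wk (A₂ ∷ []) (idG A₁ C₁) ⊔ wk (A₁ ∷ []) (idG A₂ C₂)
  idG (A₁ ∧' A₂) (C₁ ∨' C₂) = wk (C₂ ∷ []) (idG C₁ A₁) ⊔ wk (C₁ ∷ []) (idG C₂ A₂)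
  idG _ _ = emptyG

  -- Named GS4 derivations, indexed by (a list presentation of) the
  -- conclusion sequent.  Each rule requires its comma-notation
  -- conclusion to be sharing-free.
  data Deriv : List Formula → Set where
    ax  : ∀ {Δ} (Γ : List Formula) (A B : Formula) → erase A ≡ erase B →
          SharingFree (A ∷ neg B ∷ Γ) → Δ ≋ (A ∷ neg B ∷ Γ) → Deriv Δ
    cut : ∀ {Γ} (A : Formula) → SharingFree Γ →
          Deriv (A ∷ Γ) → Deriv (neg A ∷ Γ) → Deriv Γ
    sup : ∀ {Γ} → SharingFree Γ → Deriv Γ → Deriv Γ → Deriv Γ
    or  : ∀ {Δ} (Γ : List Formula) (A B : Formula) →
          SharingFree ((A ∨' B) ∷ Γ) → Δ ≋ ((A ∨' B) ∷ Γ) →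
          Deriv (A ∷ B ∷ Γ) → Deriv Δ
    and : ∀ {Δ} (Γ : List Formula) (A B : Formula) →
          SharingFree ((A ∧' B) ∷ Γ) → Δ ≋ ((A ∧' B) ∷ Γ) →
          Deriv (A ∷ Γ) → Deriv (B ∷ Γ) → Deriv Δ

  CutFree : ∀ {Δ} → Deriv Δ → Set
  CutFree (ax _ _ _ _ _ _) = ⊤
  CutFree (cut _ _ _ _) = ⊥
  CutFree (sup _ P Q) = CutFree P × CutFree Q
  CutFree (or _ _ _ _ _ P) = CutFree P
  CutFree (and _ _ _ _ _ P Q) = CutFree P × CutFree Q

  ⟪_⟫ : ∀ {Δ} → Deriv Δ → BLGraph
  ⟪ ax Γ A B _ _ _ ⟫ = wk Γ (idG A (neg B))
  ⟪ cut A _ Q R ⟫ = ⟪ Q ⟫ ⊙[ names A ] ⟪ R ⟫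
  ⟪ sup _ P Q ⟫ = ⟪ P ⟫ ⊔ ⟪ Q ⟫
  ⟪ or _ _ _ _ _ P ⟫ = ⟪ P ⟫
  ⟪ and _ _ _ _ _ P Q ⟫ = ⟪ P ⟫ ⊔ ⟪ Q ⟫

-- The graph of a derivation of ⊢ Γ satisfies a correctness criterion (Correct Γ): its vertices are the
-- names of Γ, every edge joins two complementary atom occurrences and is labelled by a branch of Γ, and
-- every branch labels some edge. Axioms, superposition, ∨ and ∧ preserve it, and so does cut: an edge
-- of G ⊙_A H is a complete alternating path, and that every branch of Γ is still covered is shown by
-- induction on A, simulating a cut on B ∨ C by a cut on B followed by a cut on C.
-- Conversely, every correct graph of a sharing-free sequent is the graph of a cut-free derivation:
-- compound formulas are decomposed by ∨ and ∧ (restricting the graph to the branches of each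
-- ∧-premiss), and for an atomic sequent the graph is the superposition of one axiom per edge.
-- A cut is eliminated by replacing it with the cut-free realization of its graph.

module Submission where

open import Defs
open import Data.Bool using (Bool; true; false; not; if_then_else_)
open import Data.Bool.Properties using (not-involutive)
open import Data.Empty using (⊥-elim)
open import Data.Nat using (ℕ; zero; suc; _+_; _≤_; s≤s; _≟_)
open import Data.Nat.Properties using (+-assoc; ≤-trans; ≤-refl; ≤-reflexive; m≤m+n; m≤n+m; n≤1+n; +-mono-≤)
open import Data.List using (List; []; _∷_; _++_; [_]; filter; map; concatMap; length; cartesianProduct)
open import Data.List.Properties using (++-assoc; filter-accept; filter-reject)
open import Data.List.Membership.Propositional using (_∈_; _∉_; find; lose)
open import Data.List.Membership.Propositional.Properties
  using (∈-++⁺ˡ; ∈-++⁺ʳ; ∈-++⁻; ∈-map⁺; ∈-concatMap⁺; ∈-filter⁺; ∈-filter⁻; ∈-cartesianProduct⁺)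
open import Data.List.Membership.DecPropositional _≟_ using (_∈?_)
open import Data.List.Relation.Binary.Subset.Propositional using (_⊆_)
open import Data.List.Relation.Binary.Subset.DecPropositional _≟_ using (_⊆?_)
open import Data.List.Relation.Unary.Any using (Any; here; there; any?)
open import Data.List.Relation.Unary.All as All using (All; []; _∷_; all?)
open import Data.List.Relation.Unary.AllPairs using ([]; _∷_)
open import Data.List.Relation.Unary.Unique.Propositional using (Unique)
import Data.List.Relation.Unary.Unique.Propositional.Properties as Unique
open import Data.List.Relation.Unary.Unique.DecPropositional _≟_ using (unique?)
open import Data.Product using (Σ; ∃; ∃₂; _×_; _,_; proj₁; proj₂)
open import Data.Sum using (_⊎_; inj₁; inj₂; [_,_]′)
open import Data.Unit using (tt)
open import Relation.Nullary using (¬_; Dec; yes; no)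
open import Relation.Nullary.Decidable using (_×-dec_; _⊎-dec_; map′; ¬?; toSum)
open import Relation.Binary.PropositionalEquality using (_≡_; _≢_; refl; sym; trans; cong; cong₂; subst)

infix 4 _≈_
infixl 6 _∩_ _∖_

_≈_ : List Name → List Name → Set
X ≈ Y = X ≐ (_∈ Y)

≈-refl : ∀ {X} → X ≈ X
≈-refl z = (λ p → p) , (λ p → p)

≈-sym : ∀ {X Y} → X ≈ Y → Y ≈ X
≈-sym e z = proj₂ (e z) , proj₁ (e z)

≐-respˡ : ∀ {X Y} {P : Name → Set} → X ≈ Y → Y ≐ P → X ≐ P
≐-respˡ e f z = (λ p → proj₁ (f z) (proj₁ (e z) p)) , (λ p → proj₂ (e z) (proj₂ (f z) p))

≐-respʳ : ∀ {X} {P Q : Name → Set} → X ≐ P → (∀ z → P z ⟺ Q z) → X ≐ Q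
≐-respʳ e f z = (λ p → proj₁ (f z) (proj₁ (e z) p)) , (λ p → proj₂ (e z) (proj₂ (f z) p))

≐-unique : ∀ {X Y} {P : Name → Set} → X ≐ P → Y ≐ P → X ≈ Y
≐-unique e f z = (λ p → proj₂ (f z) (proj₁ (e z) p)) , (λ p → proj₂ (e z) (proj₁ (f z) p))

≈? : (X Y : List Name) → Dec (X ≈ Y)
≈? X Y = map′ to from (X ⊆? Y ×-dec Y ⊆? X)
  where
  to : X ⊆ Y × Y ⊆ X → X ≈ Y
  to (f , g) z = f , g
  from : X ≈ Y → X ⊆ Y × Y ⊆ X
  from e = (λ {z} → proj₁ (e z)) , (λ {z} → proj₂ (e z))

∈-++-≐ : ∀ X {Y} → (X ++ Y) ≐ (λ z → z ∈ X ⊎ z ∈ Y)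
∈-++-≐ X z = ∈-++⁻ X , [ ∈-++⁺ˡ , ∈-++⁺ʳ X ]′

_∩_ : List Name → List Name → List Name
X ∩ N = filter (_∈? N) X

_∖_ : List Name → List Name → List Name
X ∖ N = filter (λ z → ¬? (z ∈? N)) X

∈-∩⁻ : ∀ {X N z} → z ∈ X ∩ N → z ∈ X × z ∈ N
∈-∩⁻ {N = N} = ∈-filter⁻ (_∈? N)

∈-∩⁺ : ∀ {X N z} → z ∈ X → z ∈ N → z ∈ X ∩ N
∈-∩⁺ {N = N} = ∈-filter⁺ (_∈? N)

∩-≐ : ∀ X N → (X ∩ N) ≐ (λ z → z ∈ X × z ∈ N)
∩-≐ X N z = ∈-∩⁻ , λ (p , q) → ∈-∩⁺ p q

∈-∖⁻ : ∀ {X N z} → z ∈ X ∖ N → z ∈ X × z ∉ N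
∈-∖⁻ {N = N} = ∈-filter⁻ (λ z → ¬? (z ∈? N))

∈-∖⁺ : ∀ {X N z} → z ∈ X → z ∉ N → z ∈ X ∖ N
∈-∖⁺ {N = N} = ∈-filter⁺ (λ z → ¬? (z ∈? N))

split-≈ : ∀ {X Y Z N₁ N₂} → X ⊆ N₁ → Y ⊆ N₂ → Disjoint N₁ N₂ →
          Z ≐ (λ z → z ∈ X ⊎ z ∈ Y) → X ≈ Z ∩ N₁ × Y ≈ Z ∩ N₂
split-≈ X⊆ Y⊆ d e =
  (λ z → (λ p → ∈-∩⁺ (proj₂ (e z) (inj₁ p)) (X⊆ p)) ,
         (λ p → let (p₁ , p₂) = ∈-∩⁻ p in
                [ (λ q → q) , (λ q → ⊥-elim (d z p₂ (Y⊆ q))) ]′ (proj₁ (e z) p₁))) ,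
  (λ z → (λ p → ∈-∩⁺ (proj₂ (e z) (inj₂ p)) (Y⊆ p)) ,
         (λ p → let (p₁ , p₂) = ∈-∩⁻ p in
                [ (λ q → ⊥-elim (d z (X⊆ q) p₂)) , (λ q → q) ]′ (proj₁ (e z) p₁)))

Disjoint-sym : ∀ {xs ys} → Disjoint xs ys → Disjoint ys xs
Disjoint-sym d z p q = d z q p

Disjoint-mono : ∀ {xs ys xs′ ys′} → Disjoint xs ys → xs′ ⊆ xs → ys′ ⊆ ys → Disjoint xs′ ys′
Disjoint-mono d f g z p q = d z (f p) (g q)

Unique-++⁻ : ∀ (xs : List Name) {ys} → Unique (xs ++ ys) → Unique xs × Unique ys × Disjoint xs ys
Unique-++⁻ [] u = [] , u , (λ z ())
Unique-++⁻ (x ∷ xs) (x∉ ∷ u) with Unique-++⁻ xs u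
... | uxs , uys , d = All.tabulate (λ m → All.lookup x∉ (∈-++⁺ˡ m)) ∷ uxs , uys , d′
  where
  d′ : Disjoint (x ∷ xs) _
  d′ z (here refl) q = All.lookup x∉ (∈-++⁺ʳ xs q) refl
  d′ z (there p) q = d z p q

Unique-++⁺ : ∀ {xs ys : List Name} → Unique xs → Unique ys → Disjoint xs ys → Unique (xs ++ ys)
Unique-++⁺ ux uy d = Unique.++⁺ ux uy (λ (p , q) → d _ p q)

∃-dec-within : ∀ {A : Set} {P : A → Set} (C : List A) → (∀ a → P a → a ∈ C) →
               (∀ a → Dec (P a)) → Dec (∃ P)
∃-dec-within C complete P? with any? P? C
... | yes q = let (a , _ , p) = find q in yes (a , p)
... | no ¬q = no λ (a , p) → ¬q (lose (complete a p) p)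

EdgeI-relabel : ∀ G {I X X′ u v} → X ≈ X′ → EdgeI G I u v X → EdgeI G I u v X′
EdgeI-relabel G e (Y , p , eY) = Y , p , ≐-respˡ (≈-sym e) eY

Alt-map : ∀ {G H G′ H′ I I′ X X′} →
  (∀ {u v} → EdgeI G I u v X → EdgeI G′ I′ u v X′) → (∀ {u v} → EdgeI H I u v X → EdgeI H′ I′ u v X′) →
  ∀ l → Alt G H I X l → Alt G′ H′ I′ X′ l
Alt-map f g (_ ∷ _ ∷ []) p = f p
Alt-map f g (_ ∷ y ∷ z ∷ r) (p , q) = f p , Alt-map g f (y ∷ z ∷ r) q

module Walks (G H : BLGraph) (I X : List Name) where

  Step : Bool → Name → Name → Set
  Step b x y = EdgeI (if b then G else H) I x y X

  -- Walk b e x ms y: the alternating walk x, ms, y whose first step is in graph b and last step in graph e.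
  data Walk : Bool → Bool → Name → List Name → Name → Set where
    ⟨_⟩ : ∀ {b x y} → Step b x y → Walk b b x [] y
    _◅_ : ∀ {b e x m ms y} → Step b x m → Walk (not b) e m ms y → Walk b e x (m ∷ ms) y

  AltFrom : Bool → List Name → Set
  AltFrom true = Alt G H I X
  AltFrom false = Alt H G I X

  Walk⇒Alt : ∀ {b e x ms y} → Walk b e x ms y → AltFrom b (x ∷ ms ++ y ∷ [])
  Walk⇒Alt {true} ⟨ p ⟩ = p
  Walk⇒Alt {false} ⟨ p ⟩ = p
  Walk⇒Alt {true} (p ◅ ⟨ q ⟩) = p , q
  Walk⇒Alt {false} (p ◅ ⟨ q ⟩) = p , q
  Walk⇒Alt {true} (p ◅ (q ◅ w)) = p , Walk⇒Alt (q ◅ w)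
  Walk⇒Alt {false} (p ◅ (q ◅ w)) = p , Walk⇒Alt (q ◅ w)

  Alt⇒Walk : ∀ b {x} ms {y} → AltFrom b (x ∷ ms ++ y ∷ []) → ∃ λ e → Walk b e x ms y
  Alt⇒Walk true [] p = true , ⟨ p ⟩
  Alt⇒Walk false [] p = false , ⟨ p ⟩
  Alt⇒Walk true (m ∷ []) (p , q) = false , p ◅ ⟨ q ⟩
  Alt⇒Walk false (m ∷ []) (p , q) = true , p ◅ ⟨ q ⟩
  Alt⇒Walk true (m ∷ m′ ∷ ms) (p , q) = let (e , w) = Alt⇒Walk false (m′ ∷ ms) q in e , p ◅ w
  Alt⇒Walk false (m ∷ m′ ∷ ms) (p , q) = let (e , w) = Alt⇒Walk true (m′ ∷ ms) q in e , p ◅ w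

  _◅◅_ : ∀ {b c e x ms m ms′ y} → Walk b c x ms m → Walk (not c) e m ms′ y → Walk b e x (ms ++ m ∷ ms′) y
  ⟨ p ⟩ ◅◅ w = p ◅ w
  (p ◅ w₁) ◅◅ w = p ◅ (w₁ ◅◅ w)

  firstStep : ∀ {b e x ms y} → Walk b e x ms y → ∃ λ m → Step b x m
  firstStep ⟨ p ⟩ = _ , p
  firstStep (p ◅ w) = _ , p

  lastStep : ∀ {b e x ms y} → Walk b e x ms y → ∃ λ m → Step e m y
  lastStep ⟨ p ⟩ = _ , p
  lastStep (p ◅ w) = lastStep w

  walk-vertices : (∀ {c u v} → Step c u v → (V G u ⊎ V H u) × (V G v ⊎ V H v)) →
                  ∀ {b e x ms y} → Walk b e x ms y → All (λ z → V G z ⊎ V H z) (x ∷ ms ++ y ∷ [])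
  walk-vertices f ⟨ p ⟩ = proj₁ (f p) ∷ proj₂ (f p) ∷ []
  walk-vertices f (p ◅ w) = proj₁ (f p) ∷ walk-vertices f w

  module Reverse (step-sym : ∀ {b x y} → Step b x y → Step b y x) where

    private
      flip-start : ∀ {c b z acc x} → Walk c b z acc x → Walk (not (not c)) b z acc x
      flip-start {c} = subst (λ k → Walk k _ _ _ _) (sym (not-involutive c))

      -- acc is the already reversed prefix, ending in z.
      reverse-onto : ∀ {c b d e z acc x ms y} → Walk c b z acc x → d ≡ not c → Walk d e z ms y →
                     ∃ λ ms′ → Walk e b y ms′ x × ms′ ⊆ ms ++ z ∷ acc
      reverse-onto acc refl ⟨ p ⟩ = _ , step-sym p ◅ flip-start acc , (λ r → r)
      reverse-onto {z = z} {acc} acc′ refl (_◅_ {m = m} {ms = ms} p w)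
        with reverse-onto (step-sym p ◅ flip-start acc′) refl w
      ... | ms′ , w′ , sub = ms′ , w′ , λ r → shift (sub r)
        where
        shift : ∀ {v} → v ∈ ms ++ m ∷ z ∷ acc → v ∈ (m ∷ ms) ++ z ∷ acc
        shift r with ∈-++⁻ ms r
        ... | inj₁ r′ = there (∈-++⁺ˡ r′)
        ... | inj₂ (here e) = here e
        ... | inj₂ (there r′) = there (∈-++⁺ʳ ms r′)

    reverse : ∀ {b e x ms y} → Walk b e x ms y → ∃ λ ms′ → Walk e b y ms′ x × ms′ ⊆ ms
    reverse ⟨ p ⟩ = [] , ⟨ step-sym p ⟩ , (λ ())
    reverse (_◅_ {m = m} {ms = ms} p w) with reverse-onto ⟨ step-sym p ⟩ refl w
    ... | ms′ , w′ , sub = ms′ , w′ , λ r → shift (sub r)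
      where
      shift : ∀ {v} → v ∈ ms ++ m ∷ [] → v ∈ m ∷ ms
      shift r with ∈-++⁻ ms r
      ... | inj₁ r′ = there r′
      ... | inj₂ (here e) = here e

  -- Since the side of a vertex of I is determined (side-functional), a walk through I that returns
  -- to a vertex does so on the same side, so the loop can be cut out without breaking alternation.
  module Shortcut (Side : Bool → Name → Set)
                  (side-step : ∀ {b u v} → Step b u v → Side b u → v ∈ I → Side (not b) v)
                  (side-functional : ∀ {b c v} → v ∈ I → Side b v → Side c v → b ≡ c) where

    private
      suffix-at : ∀ {b e x ms y z} → Walk b e x ms y → Side b x → All (_∈ I) ms → z ∈ ms →
                  Σ Bool λ c → Σ (List Name) λ ms′ →
                    Walk c e z ms′ y × Side c z × suc (length ms′) ≤ length ms × ms′ ⊆ ms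
      suffix-at (p ◅ w) s (mI ∷ _) (here refl) = _ , _ , w , side-step p s mI , ≤-refl , there
      suffix-at (p ◅ w) s (mI ∷ al) (there z∈) with suffix-at w (side-step p s mI) al z∈
      ... | c , ms′ , w′ , s′ , le , sub = c , ms′ , w′ , s′ , ≤-trans le (n≤1+n _) , (λ r → there (sub r))

    SimpleWalk : Bool → Name → List Name → Name → Set
    SimpleWalk b x ms y = Σ Bool λ e → Σ (List Name) λ ms′ →
      Walk b e x ms′ y × Unique (x ∷ ms′ ++ y ∷ []) × All (_∈ I) ms′ × ms′ ⊆ ms

    shortcut-bounded : ∀ n {b e x ms y} → length ms ≤ n → Walk b e x ms y → Side b x →
                       All (_∈ I) ms → y ∉ I → x ≢ y → SimpleWalk b x ms y
    shortcut-bounded n {x = x} {ms} le w s al y∉ x≢y with x ∈? ms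
    shortcut-bounded zero {ms = _ ∷ _} () w s al y∉ x≢y | yes _
    shortcut-bounded (suc n) le w s al y∉ x≢y | yes x∈ with suffix-at w s al x∈
    ... | c , ms′ , w′ , s′ , le′ , sub with side-functional (All.lookup al x∈) s s′
    ... | refl with shortcut-bounded n (≤-pred (≤-trans le′ le)) w′ s′ (All.tabulate (λ r → All.lookup al (sub r))) y∉ x≢y
      where
      ≤-pred : ∀ {a k} → suc a ≤ suc k → a ≤ k
      ≤-pred (s≤s p) = p
    ... | e , ms″ , w″ , u , al′ , sub′ = e , ms″ , w″ , u , al′ , (λ r → sub (sub′ r))
    shortcut-bounded n {ms = []} le ⟨ p ⟩ s al y∉ x≢y | no _ = _ , [] , ⟨ p ⟩ , (x≢y ∷ []) ∷ [] ∷ [] , [] , (λ ())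
    shortcut-bounded zero {ms = _ ∷ _} () (p ◅ w) s al y∉ x≢y | no _
    shortcut-bounded (suc n) {x = x} {m ∷ ms} {y} (s≤s le) (p ◅ w) s (mI ∷ al) y∉ x≢y | no x∉
      with shortcut-bounded n le w (side-step p s mI) al y∉ (λ { refl → y∉ mI })
    ... | e , ms′ , w′ , u , al′ , sub = e , m ∷ ms′ , p ◅ w′ , All.tabulate x≢ ∷ u , mI ∷ al′ , sub′
      where
      sub′ : m ∷ ms′ ⊆ m ∷ ms
      sub′ (here e) = here e
      sub′ (there r) = there (sub r)
      x≢ : ∀ {z} → z ∈ m ∷ ms′ ++ y ∷ [] → x ≢ z
      x≢ (here refl) refl = x∉ (here refl)
      x≢ (there r) refl with ∈-++⁻ ms′ r
      ... | inj₁ r′ = x∉ (there (sub r′))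
      ... | inj₂ (here refl) = x≢y refl

    shortcut : ∀ {b e x ms y} → Walk b e x ms y → Side b x → All (_∈ I) ms → y ∉ I → x ≢ y → SimpleWalk b x ms y
    shortcut w = shortcut-bounded _ ≤-refl w

sublists : List Name → List (List Name)
sublists [] = [] ∷ []
sublists (z ∷ I) = map (z ∷_) (sublists I) ++ sublists I

∩-∈-sublists : ∀ Y I → I ∩ Y ∈ sublists I
∩-∈-sublists Y [] = here refl
∩-∈-sublists Y (z ∷ I) with z ∈? Y
... | yes _ = ∈-++⁺ˡ (∈-map⁺ (z ∷_) (∩-∈-sublists Y I))
... | no _ = ∈-++⁺ʳ (map (z ∷_) (sublists I)) (∩-∈-sublists Y I)

-- A witness Y of X ◁^I may be replaced by X ++ (I ∩ Y), so only the sublists of I need to be tried.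
EdgeI-dec : ∀ G I X u v → (∀ Y → Dec (E G u v Y)) → (∀ {Y Y′} → E G u v Y → Y ≈ Y′ → E G u v Y′) →
            Dec (EdgeI G I u v X)
EdgeI-dec G I X u v E? E-resp =
  map′ to from (any? (λ S → E? (X ++ S) ×-dec ≈? X ((X ++ S) ∖ I)) (sublists I))
  where
  ∖-≐ : ∀ {Y} → X ≈ Y ∖ I → X ≐ (λ z → z ∈ Y × z ∉ I)
  ∖-≐ e z = (λ p → ∈-∖⁻ (proj₁ (e z) p)) , (λ (p , q) → proj₂ (e z) (∈-∖⁺ p q))
  ≐-∖ : ∀ {Y} → X ≐ (λ z → z ∈ Y × z ∉ I) → X ≈ Y ∖ I
  ≐-∖ e z = (λ p → let (q , r) = proj₁ (e z) p in ∈-∖⁺ q r) , (λ p → proj₂ (e z) (∈-∖⁻ p))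
  to : Any (λ S → E G u v (X ++ S) × X ≈ (X ++ S) ∖ I) (sublists I) → EdgeI G I u v X
  to a = let (S , _ , p , e) = find a in X ++ S , p , ∖-≐ e
  from : EdgeI G I u v X → Any (λ S → E G u v (X ++ S) × X ≈ (X ++ S) ∖ I) (sublists I)
  from (Y , p , e) = lose (∩-∈-sublists Y I) (E-resp p Y≈ , ≐-∖ e′)
    where
    Y≈ : Y ≈ X ++ I ∩ Y
    Y≈ z = (λ q → [ (λ z∈I → ∈-++⁺ʳ X (∈-∩⁺ z∈I q)) , (λ z∉I → ∈-++⁺ˡ (proj₂ (e z) (q , z∉I))) ]′ (toSum (z ∈? I))) ,
           (λ q → [ (λ r → proj₁ (proj₁ (e z) r)) , (λ r → proj₂ (∈-∩⁻ {I} r)) ]′ (∈-++⁻ X q))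
    e′ : X ≐ (λ z → z ∈ X ++ I ∩ Y × z ∉ I)
    e′ z = (λ q → proj₁ (Y≈ z) (proj₁ (proj₁ (e z) q)) , proj₂ (proj₁ (e z) q)) ,
           (λ (q , z∉I) → proj₂ (e z) (proj₂ (Y≈ z) q , z∉I))

Alt-dec : ∀ G H I X → (∀ u v → Dec (EdgeI G I u v X)) → (∀ u v → Dec (EdgeI H I u v X)) →
          ∀ l → Dec (Alt G H I X l)
Alt-dec G H I X G? H? [] = no (λ ())
Alt-dec G H I X G? H? (x ∷ []) = no (λ ())
Alt-dec G H I X G? H? (x ∷ y ∷ []) = G? x y
Alt-dec G H I X G? H? (x ∷ y ∷ z ∷ r) = G? x y ×-dec Alt-dec H G I X H? G? (y ∷ z ∷ r)

select : List Name → List (Name × List Name)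
select [] = []
select (z ∷ I) = (z , I) ∷ map (λ (w , r) → w , z ∷ r) (select I)

select-complete : ∀ {m} I → m ∈ I →
  ∃ λ r → (m , r) ∈ select I × (∀ {w} → w ∈ I → w ≢ m → w ∈ r) × suc (length r) ≡ length I
select-complete (z ∷ I) (here refl) =
  I , here refl , (λ { (here refl) ne → ⊥-elim (ne refl) ; (there q) _ → q }) , refl
select-complete (z ∷ I) (there p) with select-complete I p
... | r , m , f , l =
  z ∷ r , there (∈-map⁺ (λ (w , r) → w , z ∷ r) m) , (λ { (here refl) _ → here refl ; (there q) ne → there (f q ne) }) , cong suc l

distinctLists : ℕ → List Name → List (List Name)
distinctLists zero I = [] ∷ []
distinctLists (suc n) I = [] ∷ concatMap (λ (w , r) → map (w ∷_) (distinctLists n r)) (select I)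

distinctLists-complete : ∀ n I ms → length I ≤ n → Unique ms → ms ⊆ I → ms ∈ distinctLists n I
distinctLists-complete zero I [] le u sub = here refl
distinctLists-complete (suc n) I [] le u sub = here refl
distinctLists-complete zero [] (m ∷ ms) le u sub with sub (here refl)
... | ()
distinctLists-complete zero (_ ∷ _) (m ∷ ms) () u sub
distinctLists-complete (suc n) I (m ∷ ms) le (m∉ ∷ u) sub with select-complete I (sub (here refl))
... | r , mr , f , l =
  there (∈-concatMap⁺ (λ (w , r) → map (w ∷_) (distinctLists n r))
    (lose mr (∈-map⁺ (m ∷_) (distinctLists-complete n r ms le′ u sub′))))
  where
  le′ : length r ≤ n
  le′ with subst (_≤ suc n) (sym l) le
  ... | s≤s q = q
  sub′ : ms ⊆ r
  sub′ q = f (sub (there q)) (λ e → All.lookup m∉ q (sym e))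

CompletePath-dec : ∀ G H I X x y →
  (∀ u v → Dec (EdgeI G I u v X)) → (∀ u v → Dec (EdgeI H I u v X)) → (∀ z → Dec (V G z ⊎ V H z)) →
  Dec (CompletePath G H I X x y)
CompletePath-dec G H I X x y G? H? V? = ∃-dec-within (distinctLists (length I) I) complete path?
  where
  complete : ∀ ms → _ → ms ∈ distinctLists (length I) I
  complete ms (_ ∷ u , inI , _) =
    distinctLists-complete (length I) I ms ≤-refl (proj₁ (Unique-++⁻ ms u)) (All.lookup inI)
  path? : ∀ ms → Dec _
  path? ms = unique? (x ∷ ms ++ y ∷ []) ×-dec all? (_∈? I) ms ×-dec ¬? (x ∈? I) ×-dec ¬? (y ∈? I)
             ×-dec all? V? (x ∷ ms ++ y ∷ [])
             ×-dec (Alt-dec G H I X G? H? (x ∷ ms ++ y ∷ []) ⊎-dec Alt-dec H G I X H? G? (x ∷ ms ++ y ∷ []))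

module _ (Atom : Set) (bar : Atom → Atom)
         (bar-involutive : ∀ a → bar (bar a) ≡ a) (bar-fixpoint-free : ∀ a → bar a ≢ a) where

  open GS4 Atom bar

  data Occ : Formula → Name → Atom → Set where
    occ    : ∀ {a x} → Occ (at a x) x a
    occ-∨ˡ : ∀ {A B x a} → Occ A x a → Occ (A ∨' B) x a
    occ-∨ʳ : ∀ {A B x a} → Occ B x a → Occ (A ∨' B) x a
    occ-∧ˡ : ∀ {A B x a} → Occ A x a → Occ (A ∧' B) x a
    occ-∧ʳ : ∀ {A B x a} → Occ B x a → Occ (A ∧' B) x a

  Occ⇒∈ : ∀ {A x a} → Occ A x a → x ∈ names A
  Occ⇒∈ occ = here refl
  Occ⇒∈ (occ-∨ˡ p) = ∈-++⁺ˡ (Occ⇒∈ p)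
  Occ⇒∈ (occ-∨ʳ {A} p) = ∈-++⁺ʳ (names A) (Occ⇒∈ p)
  Occ⇒∈ (occ-∧ˡ p) = ∈-++⁺ˡ (Occ⇒∈ p)
  Occ⇒∈ (occ-∧ʳ {A} p) = ∈-++⁺ʳ (names A) (Occ⇒∈ p)

  ∈⇒Occ : ∀ {A x} → x ∈ names A → ∃ λ a → Occ A x a
  ∈⇒Occ {at a y} (here refl) = a , occ
  ∈⇒Occ {A ∨' B} p with ∈-++⁻ (names A) p
  ... | inj₁ q = let (a , r) = ∈⇒Occ q in a , occ-∨ˡ r
  ... | inj₂ q = let (a , r) = ∈⇒Occ q in a , occ-∨ʳ r
  ∈⇒Occ {A ∧' B} p with ∈-++⁻ (names A) p
  ... | inj₁ q = let (a , r) = ∈⇒Occ q in a , occ-∧ˡ r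
  ... | inj₂ q = let (a , r) = ∈⇒Occ q in a , occ-∧ʳ r

  names-neg : ∀ A → names (neg A) ≡ names A
  names-neg (at a x) = refl
  names-neg (A ∨' B) = cong₂ _++_ (names-neg A) (names-neg B)
  names-neg (A ∧' B) = cong₂ _++_ (names-neg A) (names-neg B)

  neg-involutive : ∀ A → neg (neg A) ≡ A
  neg-involutive (at a x) = cong (λ b → at b x) (bar-involutive a)
  neg-involutive (A ∨' B) = cong₂ _∨'_ (neg-involutive A) (neg-involutive B)
  neg-involutive (A ∧' B) = cong₂ _∧'_ (neg-involutive A) (neg-involutive B)

  neg≢ : ∀ A → neg A ≢ A
  neg≢ (at a x) e = bar-fixpoint-free a (cong atom-of e)
    where
    atom-of : Formula → Atom
    atom-of (at b _) = b
    atom-of _ = a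
  neg≢ (A ∨' B) ()
  neg≢ (A ∧' B) ()

  Occ-neg⁺ : ∀ {A x a} → Occ A x a → Occ (neg A) x (bar a)
  Occ-neg⁺ occ = occ
  Occ-neg⁺ (occ-∨ˡ p) = occ-∧ˡ (Occ-neg⁺ p)
  Occ-neg⁺ (occ-∨ʳ p) = occ-∧ʳ (Occ-neg⁺ p)
  Occ-neg⁺ (occ-∧ˡ p) = occ-∨ˡ (Occ-neg⁺ p)
  Occ-neg⁺ (occ-∧ʳ p) = occ-∨ʳ (Occ-neg⁺ p)

  Occ-neg⁻ : ∀ {A x a} → Occ (neg A) x a → Occ A x (bar a)
  Occ-neg⁻ {at b y} occ = subst (Occ (at b y) y) (sym (bar-involutive b)) occ
  Occ-neg⁻ {A ∨' B} (occ-∧ˡ p) = occ-∨ˡ (Occ-neg⁻ p)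
  Occ-neg⁻ {A ∨' B} (occ-∧ʳ p) = occ-∨ʳ (Occ-neg⁻ p)
  Occ-neg⁻ {A ∧' B} (occ-∨ˡ p) = occ-∧ˡ (Occ-neg⁻ p)
  Occ-neg⁻ {A ∧' B} (occ-∨ʳ p) = occ-∧ʳ (Occ-neg⁻ p)

  Occ-functional : ∀ {A x a b} → SharingFreeF A → Occ A x a → Occ A x b → a ≡ b
  Occ-functional u occ occ = refl
  Occ-functional {A ∨' B} u p q with Unique-++⁻ (names A) u | p | q
  ... | uA , _ , _ | occ-∨ˡ p′ | occ-∨ˡ q′ = Occ-functional uA p′ q′
  ... | _ , uB , _ | occ-∨ʳ p′ | occ-∨ʳ q′ = Occ-functional uB p′ q′
  ... | _ , _ , d | occ-∨ˡ p′ | occ-∨ʳ q′ = ⊥-elim (d _ (Occ⇒∈ p′) (Occ⇒∈ q′))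
  ... | _ , _ , d | occ-∨ʳ p′ | occ-∨ˡ q′ = ⊥-elim (d _ (Occ⇒∈ q′) (Occ⇒∈ p′))
  Occ-functional {A ∧' B} u p q with Unique-++⁻ (names A) u | p | q
  ... | uA , _ , _ | occ-∧ˡ p′ | occ-∧ˡ q′ = Occ-functional uA p′ q′
  ... | _ , uB , _ | occ-∧ʳ p′ | occ-∧ʳ q′ = Occ-functional uB p′ q′
  ... | _ , _ , d | occ-∧ˡ p′ | occ-∧ʳ q′ = ⊥-elim (d _ (Occ⇒∈ p′) (Occ⇒∈ q′))
  ... | _ , _ , d | occ-∧ʳ p′ | occ-∧ˡ q′ = ⊥-elim (d _ (Occ⇒∈ q′) (Occ⇒∈ p′))

  UniqueNames : List Formula → Set
  UniqueNames Γ = Unique (namesΓ Γ)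

  ∈-namesΓ⁻ : ∀ {z} Γ → z ∈ namesΓ Γ → ∃ λ A → A ∈ Γ × z ∈ names A
  ∈-namesΓ⁻ (A ∷ Γ) p with ∈-++⁻ (names A) p
  ... | inj₁ q = A , here refl , q
  ... | inj₂ q = let (B , m , r) = ∈-namesΓ⁻ Γ q in B , there m , r

  ∈-namesΓ⁺ : ∀ {z A Γ} → A ∈ Γ → z ∈ names A → z ∈ namesΓ Γ
  ∈-namesΓ⁺ {Γ = A ∷ Γ} (here refl) q = ∈-++⁺ˡ q
  ∈-namesΓ⁺ {Γ = B ∷ Γ} (there m) q = ∈-++⁺ʳ (names B) (∈-namesΓ⁺ m q)

  namesΓ-++ : ∀ Δ Γ → namesΓ (Δ ++ Γ) ≡ namesΓ Δ ++ namesΓ Γ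
  namesΓ-++ [] Γ = refl
  namesΓ-++ (A ∷ Δ) Γ = trans (cong (names A ++_) (namesΓ-++ Δ Γ)) (sym (++-assoc (names A) (namesΓ Δ) (namesΓ Γ)))

  ∈-namesΓ-++⁻ : ∀ Δ Γ {z} → z ∈ namesΓ (Δ ++ Γ) → z ∈ namesΓ Δ ⊎ z ∈ namesΓ Γ
  ∈-namesΓ-++⁻ Δ Γ p = ∈-++⁻ (namesΓ Δ) (subst (_ ∈_) (namesΓ-++ Δ Γ) p)

  ∈-namesΓ-++⁺ : ∀ Δ Γ {z} → z ∈ namesΓ Δ ⊎ z ∈ namesΓ Γ → z ∈ namesΓ (Δ ++ Γ)
  ∈-namesΓ-++⁺ Δ Γ p = subst (_ ∈_) (sym (namesΓ-++ Δ Γ)) ([ ∈-++⁺ˡ , ∈-++⁺ʳ (namesΓ Δ) ]′ p)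

  namesΓ-≋ : ∀ {Γ Γ′} → Γ ≋ Γ′ → namesΓ Γ ≈ namesΓ Γ′
  namesΓ-≋ {Γ} {Γ′} e z = move e , move (λ A → proj₂ (e A) , proj₁ (e A))
    where
    move : ∀ {Δ Δ′} → Δ ≋ Δ′ → z ∈ namesΓ Δ → z ∈ namesΓ Δ′
    move {Δ} e p = let (A , m , q) = ∈-namesΓ⁻ Δ p in ∈-namesΓ⁺ (proj₁ (e A) m) q

  UniqueNames-∷⁻ : ∀ {A Γ} → UniqueNames (A ∷ Γ) → SharingFreeF A × UniqueNames Γ × Disjoint (names A) (namesΓ Γ)
  UniqueNames-∷⁻ {A} = Unique-++⁻ (names A)

  UniqueNames-∷⁺ : ∀ {A Γ} → SharingFreeF A → UniqueNames Γ → Disjoint (names A) (namesΓ Γ) → UniqueNames (A ∷ Γ)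
  UniqueNames-∷⁺ = Unique-++⁺

  SharingFree⇒UniqueNames : ∀ {Γ} → SharingFree Γ → UniqueNames Γ
  SharingFree⇒UniqueNames {[]} _ = []
  SharingFree⇒UniqueNames {A ∷ Γ} (u ∷ us , d ∷ ds) =
    Unique-++⁺ u (SharingFree⇒UniqueNames (us , ds))
      (λ z p q → let (B , m , r) = ∈-namesΓ⁻ Γ q in All.lookup d m z p r)

  UniqueNames⇒SharingFree : ∀ {Γ} → UniqueNames Γ → SharingFree Γ
  UniqueNames⇒SharingFree {[]} _ = [] , []
  UniqueNames⇒SharingFree {A ∷ Γ} u with UniqueNames-∷⁻ {A} {Γ} u
  ... | uA , uΓ , d with UniqueNames⇒SharingFree {Γ} uΓ
  ... | us , ds = uA ∷ us , All.tabulate (λ m z p q → d z p (∈-namesΓ⁺ m q)) ∷ ds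

  UniqueNames-++⁻ : ∀ Δ Γ → UniqueNames (Δ ++ Γ) → UniqueNames Δ × UniqueNames Γ × Disjoint (namesΓ Δ) (namesΓ Γ)
  UniqueNames-++⁻ Δ Γ u = Unique-++⁻ (namesΓ Δ) (subst Unique (namesΓ-++ Δ Γ) u)

  UniqueNames-to-front : ∀ pre F post → UniqueNames (pre ++ F ∷ post) → UniqueNames (F ∷ pre ++ post)
  UniqueNames-to-front pre F post u with UniqueNames-++⁻ pre (F ∷ post) u
  ... | upre , uFpost , d with UniqueNames-∷⁻ {F} {post} uFpost
  ... | uF , upost , dF = UniqueNames-∷⁺ {F} {pre ++ post} uF
    (subst Unique (sym (namesΓ-++ pre post)) (Unique-++⁺ upre upost (λ z p q → d z p (∈-++⁺ʳ (names F) q))))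
    (λ z p q → [ (λ w → d z w (∈-++⁺ˡ p)) , dF z p ]′ (∈-namesΓ-++⁻ pre post q))

  UniqueNames-++-comm : ∀ Δ Γ → UniqueNames (Δ ++ Γ) → UniqueNames (Γ ++ Δ)
  UniqueNames-++-comm Δ Γ u with UniqueNames-++⁻ Δ Γ u
  ... | uΔ , uΓ , d = subst Unique (sym (namesΓ-++ Γ Δ)) (Unique-++⁺ uΓ uΔ (Disjoint-sym d))

  UniqueNames-neg : ∀ {A Γ} → UniqueNames (A ∷ Γ) → UniqueNames (neg A ∷ Γ)
  UniqueNames-neg {A} {Γ} = subst (λ N → Unique (N ++ namesΓ Γ)) (sym (names-neg A))

  UniqueNames-shared : ∀ {Γ A B z} → UniqueNames Γ → A ∈ Γ → B ∈ Γ → z ∈ names A → z ∈ names B → A ≡ B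
  UniqueNames-shared u (here refl) (here refl) p q = refl
  UniqueNames-shared {C ∷ Γ} u (here refl) (there m) p q = ⊥-elim (proj₂ (proj₂ (UniqueNames-∷⁻ {C} {Γ} u)) _ p (∈-namesΓ⁺ m q))
  UniqueNames-shared {C ∷ Γ} u (there m) (here refl) p q = ⊥-elim (proj₂ (proj₂ (UniqueNames-∷⁻ {C} {Γ} u)) _ q (∈-namesΓ⁺ m p))
  UniqueNames-shared {C ∷ Γ} u (there m) (there m′) p q = UniqueNames-shared (proj₁ (proj₂ (UniqueNames-∷⁻ {C} {Γ} u))) m m′ p q

  OccΓ : List Formula → Name → Atom → Set
  OccΓ Γ x a = Any (λ A → Occ A x a) Γ

  OccΓ⇒∈ : ∀ {Γ x a} → OccΓ Γ x a → x ∈ namesΓ Γ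
  OccΓ⇒∈ p = let (A , m , q) = find p in ∈-namesΓ⁺ m (Occ⇒∈ q)

  ∈⇒OccΓ : ∀ {Γ x} → x ∈ namesΓ Γ → ∃ λ a → OccΓ Γ x a
  ∈⇒OccΓ {Γ} p = let (A , m , q) = ∈-namesΓ⁻ Γ p ; (a , r) = ∈⇒Occ q in a , lose m r

  OccΓ-≋ : ∀ {Γ Γ′ x a} → Γ ≋ Γ′ → OccΓ Γ x a → OccΓ Γ′ x a
  OccΓ-≋ e p = let (A , m , q) = find p in lose (proj₁ (e A) m) q

  OccΓ-functional : ∀ {Γ x a b} → UniqueNames Γ → OccΓ Γ x a → OccΓ Γ x b → a ≡ b
  OccΓ-functional {Γ} u p q with find p | find q
  ... | A , m , p′ | B , m′ , q′ with UniqueNames-shared u m m′ (Occ⇒∈ p′) (Occ⇒∈ q′)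
  ... | refl = Occ-functional (All.lookup (proj₁ (UniqueNames⇒SharingFree u)) m) p′ q′

  Complementary : List Formula → Name → Name → Set
  Complementary Γ x y = ∃ λ a → OccΓ Γ x a × OccΓ Γ y (bar a)

  Complementary-sym : ∀ {Γ x y} → Complementary Γ x y → Complementary Γ y x
  Complementary-sym {Γ} {x} (a , p , q) = bar a , q , subst (OccΓ Γ x) (sym (bar-involutive a)) p

  Complementary⇒≢ : ∀ {Γ x y} → UniqueNames Γ → Complementary Γ x y → x ≢ y
  Complementary⇒≢ u (a , p , q) refl = bar-fixpoint-free a (sym (OccΓ-functional u p q))

  Complementary-≋ : ∀ {Γ Γ′ x y} → Γ ≋ Γ′ → Complementary Γ x y → Complementary Γ′ x y
  Complementary-≋ e (a , p , q) = a , OccΓ-≋ e p , OccΓ-≋ e q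

  InBr-⊆ : ∀ {A Y} → InBr A Y → Y ⊆ names A
  InBr-⊆ {at a x} b p = here (proj₁ (b _) p)
  InBr-⊆ {A ∨' B} (Y , Z , b , c , e) p with proj₁ (e _) p
  ... | inj₁ q = ∈-++⁺ˡ (InBr-⊆ b q)
  ... | inj₂ q = ∈-++⁺ʳ (names A) (InBr-⊆ c q)
  InBr-⊆ {A ∧' B} (inj₁ b) p = ∈-++⁺ˡ (InBr-⊆ b p)
  InBr-⊆ {A ∧' B} (inj₂ b) p = ∈-++⁺ʳ (names A) (InBr-⊆ b p)

  InBr-resp : ∀ {A Y Y′} → InBr A Y → Y ≈ Y′ → InBr A Y′
  InBr-resp {at a x} b e = ≐-respˡ (≈-sym e) b
  InBr-resp {A ∨' B} (Y , Z , b , c , f) e = Y , Z , b , c , ≐-respˡ (≈-sym e) f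
  InBr-resp {A ∧' B} (inj₁ b) e = inj₁ (InBr-resp b e)
  InBr-resp {A ∧' B} (inj₂ b) e = inj₂ (InBr-resp b e)

  BranchAt : List Name → Formula → Set
  BranchAt X A = ∃ λ Y → InBr A Y × (Y ≐ λ z → z ∈ X × z ∈ names A)

  BranchAt-resp : ∀ {X X′ A} → (∀ z → z ∈ names A → z ∈ X → z ∈ X′) → (∀ z → z ∈ names A → z ∈ X′ → z ∈ X) →
                  BranchAt X A → BranchAt X′ A
  BranchAt-resp f g (Y , b , e) =
    Y , b , λ z → (λ p → let (x₁ , x₂) = proj₁ (e z) p in f z x₂ x₁ , x₂) , (λ (x₁ , x₂) → proj₂ (e z) (g z x₂ x₁ , x₂))

  BrΓ-⊆ : ∀ {Γ X} → BrΓ Γ X → X ⊆ namesΓ Γ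
  BrΓ-⊆ (s , _) {z} = s z

  BrΓ-resp : ∀ {Γ X X′} → BrΓ Γ X → X ≈ X′ → BrΓ Γ X′
  BrΓ-resp (s , al) e =
    (λ z p → s z (proj₂ (e z) p)) ,
    All.map (BranchAt-resp (λ z _ → proj₁ (e z)) (λ z _ → proj₂ (e z))) al

  BrΓ-≋ : ∀ {Γ Γ′ X} → Γ ≋ Γ′ → BrΓ Γ X → BrΓ Γ′ X
  BrΓ-≋ e (s , al) = (λ z p → proj₁ (namesΓ-≋ e z) (s z p)) , All.tabulate (λ m → All.lookup al (proj₂ (e _) m))

  InBr-dec : ∀ A → SharingFreeF A → ∀ Y → Dec (InBr A Y)
  InBr-dec (at a x) u Y = map′ (λ e → ≐-respʳ e singleton) (λ e → ≐-respʳ e (λ z → proj₂ (singleton z) , proj₁ (singleton z))) (≈? Y [ x ])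
    where
    singleton : ∀ z → (z ∈ [ x ]) ⟺ (z ≡ x)
    singleton z = (λ { (here q) → q }) , here
  InBr-dec (A ∨' B) u Y with Unique-++⁻ (names A) u
  ... | uA , uB , d =
    map′ to from (InBr-dec A uA (Y ∩ names A) ×-dec InBr-dec B uB (Y ∩ names B) ×-dec Y ⊆? names A ++ names B)
    where
    to : InBr A (Y ∩ names A) × InBr B (Y ∩ names B) × Y ⊆ names A ++ names B → InBr (A ∨' B) Y
    to (b , c , s) = Y ∩ names A , Y ∩ names B , b , c , λ z →
      (λ p → [ (λ q → inj₁ (∈-∩⁺ p q)) , (λ q → inj₂ (∈-∩⁺ p q)) ]′ (∈-++⁻ (names A) (s p))) ,
      [ (λ q → proj₁ (∈-∩⁻ q)) , (λ q → proj₁ (∈-∩⁻ q)) ]′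
    from : InBr (A ∨' B) Y → InBr A (Y ∩ names A) × InBr B (Y ∩ names B) × Y ⊆ names A ++ names B
    from (Y₁ , Y₂ , b , c , e) with split-≈ (InBr-⊆ b) (InBr-⊆ c) d e
    ... | e₁ , e₂ = InBr-resp b e₁ , InBr-resp c e₂ ,
                    λ p → [ (λ q → ∈-++⁺ˡ (InBr-⊆ b q)) , (λ q → ∈-++⁺ʳ (names A) (InBr-⊆ c q)) ]′ (proj₁ (e _) p)
  InBr-dec (A ∧' B) u Y with Unique-++⁻ (names A) u
  ... | uA , uB , _ = InBr-dec A uA Y ⊎-dec InBr-dec B uB Y

  BrΓ-dec : ∀ Γ → UniqueNames Γ → ∀ X → Dec (BrΓ Γ X)
  BrΓ-dec Γ u X = map′ (λ (s , al) → (λ z p → s p) , al) (λ (s , al) → (λ {z} → s z) , al) (X ⊆? namesΓ Γ ×-dec components Γ u)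
    where
    components : ∀ Δ → UniqueNames Δ → Dec (All (BranchAt X) Δ)
    components [] _ = yes []
    components (A ∷ Δ) u with UniqueNames-∷⁻ {A} {Δ} u
    ... | uA , uΔ , _ with InBr-dec A uA (X ∩ names A) | components Δ uΔ
    ... | yes b | yes r = yes ((X ∩ names A , b , ∩-≐ X (names A)) ∷ r)
    ... | no ¬b | _ = no λ { ((Y , b , e) ∷ _) → ¬b (InBr-resp b (≐-unique e (∩-≐ X (names A)))) }
    ... | yes _ | no ¬r = no λ { (_ ∷ r) → ¬r r }

  ≅-refl : ∀ {G} → G ≅ G
  ≅-refl = (λ z → (λ p → p) , (λ p → p)) , (λ x y X → (λ p → p) , (λ p → p))

  ≅-trans : ∀ {G H K} → G ≅ H → H ≅ K → G ≅ K
  ≅-trans (v , e) (v′ , e′) =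
    (λ z → (λ p → proj₁ (v′ z) (proj₁ (v z) p)) , (λ p → proj₂ (v z) (proj₂ (v′ z) p))) ,
    (λ x y X → (λ p → proj₁ (e′ x y X) (proj₁ (e x y X) p)) , (λ p → proj₂ (e x y X) (proj₂ (e′ x y X) p)))

  ⊔-cong : ∀ {G G′ H H′} → G ≅ G′ → H ≅ H′ → (G ⊔ H) ≅ (G′ ⊔ H′)
  ⊔-cong (v , e) (v′ , e′) =
    (λ z → (λ { (inj₁ p) → inj₁ (proj₁ (v z) p) ; (inj₂ p) → inj₂ (proj₁ (v′ z) p) }) ,
           (λ { (inj₁ p) → inj₁ (proj₂ (v z) p) ; (inj₂ p) → inj₂ (proj₂ (v′ z) p) })) ,
    (λ x y X → (λ { (inj₁ p) → inj₁ (proj₁ (e x y X) p) ; (inj₂ p) → inj₂ (proj₁ (e′ x y X) p) }) ,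
               (λ { (inj₁ p) → inj₁ (proj₂ (e x y X) p) ; (inj₂ p) → inj₂ (proj₂ (e′ x y X) p) }))

  record Correct (Γ : List Formula) (G : BLGraph) : Set where
    field
      vertices      : ∀ z → V G z ⟺ (z ∈ namesΓ Γ)
      label-branch  : ∀ {x y X} → E G x y X → BrΓ Γ X
      ends-in-label : ∀ {x y X} → E G x y X → x ∈ X × y ∈ X
      complementary : ∀ {x y X} → E G x y X → Complementary Γ x y
      edge-sym      : ∀ {x y X} → E G x y X → E G y x X
      edge-resp     : ∀ {x y X X′} → E G x y X → X ≈ X′ → E G x y X′
      covers        : ∀ {X} → BrΓ Γ X → ∃₂ λ x y → E G x y X
      edge?         : ∀ x y X → Dec (E G x y X)
  open Correct public

  Correct-≅ : ∀ {Γ G H} → G ≅ H → Correct Γ G → Correct Γ H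
  Correct-≅ {Γ} {G} {H} (v , e) C = record
    { vertices = λ z → (λ p → proj₁ (vertices C z) (proj₂ (v z) p)) , (λ p → proj₁ (v z) (proj₂ (vertices C z) p))
    ; label-branch = λ p → label-branch C (from p)
    ; ends-in-label = λ p → ends-in-label C (from p)
    ; complementary = λ p → complementary C (from p)
    ; edge-sym = λ p → to (edge-sym C (from p))
    ; edge-resp = λ p q → to (edge-resp C (from p) q)
    ; covers = λ b → let (x , y , p) = covers C b in x , y , to p
    ; edge? = λ x y X → map′ to from (edge? C x y X) }
    where
    to : ∀ {x y X} → E G x y X → E H x y X
    to {x} {y} {X} = proj₁ (e x y X)
    from : ∀ {x y X} → E H x y X → E G x y X
    from {x} {y} {X} = proj₂ (e x y X)

  Correct-transfer : ∀ {Γ Γ′ G} → namesΓ Γ ≈ namesΓ Γ′ →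
    (∀ {x y} → Complementary Γ x y → Complementary Γ′ x y) →
    (∀ {X} → BrΓ Γ X → BrΓ Γ′ X) → (∀ {X} → BrΓ Γ′ X → BrΓ Γ X) → Correct Γ G → Correct Γ′ G
  Correct-transfer n c b b′ C = record
    { vertices = λ z → (λ p → proj₁ (n z) (proj₁ (vertices C z) p)) , (λ p → proj₂ (vertices C z) (proj₂ (n z) p))
    ; label-branch = λ p → b (label-branch C p)
    ; ends-in-label = ends-in-label C
    ; complementary = λ p → c (complementary C p)
    ; edge-sym = edge-sym C
    ; edge-resp = edge-resp C
    ; covers = λ x → covers C (b′ x)
    ; edge? = edge? C }

  ≋-sym : ∀ {Γ Δ} → Γ ≋ Δ → Δ ≋ Γ
  ≋-sym e A = proj₂ (e A) , proj₁ (e A)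

  Correct-≋ : ∀ {Γ Γ′ G} → Γ ≋ Γ′ → Correct Γ G → Correct Γ′ G
  Correct-≋ e = Correct-transfer (namesΓ-≋ e) (Complementary-≋ e) (BrΓ-≋ e) (BrΓ-≋ (≋-sym e))

  Correct-⊔ : ∀ {Γ G H} → Correct Γ G → Correct Γ H → Correct Γ (G ⊔ H)
  Correct-⊔ C D = record
    { vertices = λ z → [ proj₁ (vertices C z) , proj₁ (vertices D z) ]′ , (λ p → inj₁ (proj₂ (vertices C z) p))
    ; label-branch = [ label-branch C , label-branch D ]′
    ; ends-in-label = [ ends-in-label C , ends-in-label D ]′
    ; complementary = [ complementary C , complementary D ]′
    ; edge-sym = λ { (inj₁ p) → inj₁ (edge-sym C p) ; (inj₂ p) → inj₂ (edge-sym D p) }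
    ; edge-resp = λ { (inj₁ p) q → inj₁ (edge-resp C p q) ; (inj₂ p) q → inj₂ (edge-resp D p q) }
    ; covers = λ b → let (x , y , p) = covers C b in x , y , inj₁ p
    ; edge? = λ x y X → edge? C x y X ⊎-dec edge? D x y X }

  namesΓ-∨ : ∀ A B Γ → namesΓ (A ∷ B ∷ Γ) ≡ namesΓ ((A ∨' B) ∷ Γ)
  namesΓ-∨ A B Γ = sym (++-assoc (names A) (names B) (namesΓ Γ))

  OccΓ-∨⁺ : ∀ {A B Γ x a} → OccΓ (A ∷ B ∷ Γ) x a → OccΓ ((A ∨' B) ∷ Γ) x a
  OccΓ-∨⁺ (here p) = here (occ-∨ˡ p)
  OccΓ-∨⁺ (there (here p)) = here (occ-∨ʳ p)
  OccΓ-∨⁺ (there (there q)) = there q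

  OccΓ-∨⁻ : ∀ {A B Γ x a} → OccΓ ((A ∨' B) ∷ Γ) x a → OccΓ (A ∷ B ∷ Γ) x a
  OccΓ-∨⁻ (here (occ-∨ˡ p)) = here p
  OccΓ-∨⁻ (here (occ-∨ʳ p)) = there (here p)
  OccΓ-∨⁻ (there q) = there (there q)

  BrΓ-∨⁺ : ∀ {A B Γ X} → BrΓ (A ∷ B ∷ Γ) X → BrΓ ((A ∨' B) ∷ Γ) X
  BrΓ-∨⁺ {A} {B} {Γ} {X} (s , (Y₁ , b₁ , e₁) ∷ (Y₂ , b₂ , e₂) ∷ r) =
    (λ z p → subst (z ∈_) (namesΓ-∨ A B Γ) (s z p)) , (Y₁ ++ Y₂ , (Y₁ , Y₂ , b₁ , b₂ , ∈-++-≐ Y₁) , e) ∷ r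
    where
    e : (Y₁ ++ Y₂) ≐ (λ z → z ∈ X × z ∈ names A ++ names B)
    e z = (λ p → [ (λ q → let (x₁ , x₂) = proj₁ (e₁ z) q in x₁ , ∈-++⁺ˡ x₂)
                  , (λ q → let (x₁ , x₂) = proj₁ (e₂ z) q in x₁ , ∈-++⁺ʳ (names A) x₂) ]′ (∈-++⁻ Y₁ p)) ,
          (λ (x₁ , x₂) → [ (λ q → ∈-++⁺ˡ (proj₂ (e₁ z) (x₁ , q))) , (λ q → ∈-++⁺ʳ Y₁ (proj₂ (e₂ z) (x₁ , q))) ]′
                           (∈-++⁻ (names A) x₂))

  BrΓ-∨⁻ : ∀ {A B Γ X} → Disjoint (names A) (names B) → BrΓ ((A ∨' B) ∷ Γ) X → BrΓ (A ∷ B ∷ Γ) X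
  BrΓ-∨⁻ {A} {B} {Γ} {X} d (s , (Y , (Y₁ , Y₂ , b₁ , b₂ , f) , e) ∷ r) =
    (λ z p → subst (z ∈_) (sym (namesΓ-∨ A B Γ)) (s z p)) , (Y₁ , b₁ , e₁) ∷ (Y₂ , b₂ , e₂) ∷ r
    where
    e₁ : Y₁ ≐ (λ z → z ∈ X × z ∈ names A)
    e₁ z = (λ p → proj₁ (proj₁ (e z) (proj₂ (f z) (inj₁ p))) , InBr-⊆ b₁ p) ,
           (λ (x₁ , x₂) → [ (λ q → q) , (λ q → ⊥-elim (d z x₂ (InBr-⊆ b₂ q))) ]′
                            (proj₁ (f z) (proj₂ (e z) (x₁ , ∈-++⁺ˡ x₂))))
    e₂ : Y₂ ≐ (λ z → z ∈ X × z ∈ names B)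
    e₂ z = (λ p → proj₁ (proj₁ (e z) (proj₂ (f z) (inj₂ p))) , InBr-⊆ b₂ p) ,
           (λ (x₁ , x₂) → [ (λ q → ⊥-elim (d z (InBr-⊆ b₁ q) x₂)) , (λ q → q) ]′
                            (proj₁ (f z) (proj₂ (e z) (x₁ , ∈-++⁺ʳ (names A) x₂))))

  ∨-disjoint : ∀ {A B Γ} → UniqueNames ((A ∨' B) ∷ Γ) → Disjoint (names A) (names B)
  ∨-disjoint {A} {B} {Γ} u = proj₂ (proj₂ (Unique-++⁻ (names A) (proj₁ (UniqueNames-∷⁻ {A ∨' B} {Γ} u))))

  namesΓ-∨-≈ : ∀ A B Γ → namesΓ (A ∷ B ∷ Γ) ≈ namesΓ ((A ∨' B) ∷ Γ)
  namesΓ-∨-≈ A B Γ z = subst (z ∈_) (namesΓ-∨ A B Γ) , subst (z ∈_) (sym (namesΓ-∨ A B Γ))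

  Correct-∨⁺ : ∀ {A B Γ G} → UniqueNames ((A ∨' B) ∷ Γ) → Correct (A ∷ B ∷ Γ) G → Correct ((A ∨' B) ∷ Γ) G
  Correct-∨⁺ {A} {B} {Γ} u = Correct-transfer (namesΓ-∨-≈ A B Γ)
    (λ (a , p , q) → a , OccΓ-∨⁺ p , OccΓ-∨⁺ q) BrΓ-∨⁺ (BrΓ-∨⁻ (∨-disjoint {A} {B} {Γ} u))

  Correct-∨⁻ : ∀ {A B Γ G} → UniqueNames ((A ∨' B) ∷ Γ) → Correct ((A ∨' B) ∷ Γ) G → Correct (A ∷ B ∷ Γ) G
  Correct-∨⁻ {A} {B} {Γ} u = Correct-transfer (≈-sym (namesΓ-∨-≈ A B Γ))
    (λ (a , p , q) → a , OccΓ-∨⁻ p , OccΓ-∨⁻ q) (BrΓ-∨⁻ (∨-disjoint {A} {B} {Γ} u)) BrΓ-∨⁺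

  record ∧-Separated (A B : Formula) (Γ : List Formula) : Set where
    field
      A∥B : Disjoint (names A) (names B)
      A∥Γ : Disjoint (names A) (namesΓ Γ)
      B∥Γ : Disjoint (names B) (namesΓ Γ)
  open ∧-Separated

  ∧-separated : ∀ {A B Γ} → UniqueNames ((A ∧' B) ∷ Γ) → ∧-Separated A B Γ
  ∧-separated {A} {B} {Γ} u with UniqueNames-∷⁻ {A ∧' B} {Γ} u
  ... | uAB , _ , d = record
    { A∥B = proj₂ (proj₂ (Unique-++⁻ (names A) uAB))
    ; A∥Γ = λ z p q → d z (∈-++⁺ˡ p) q
    ; B∥Γ = λ z p q → d z (∈-++⁺ʳ (names A) p) q }

  UniqueNames-∧ˡ : ∀ {A B Γ} → UniqueNames ((A ∧' B) ∷ Γ) → UniqueNames (A ∷ Γ)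
  UniqueNames-∧ˡ {A} {B} {Γ} u with UniqueNames-∷⁻ {A ∧' B} {Γ} u
  ... | uAB , uΓ , _ = Unique-++⁺ (proj₁ (Unique-++⁻ (names A) uAB)) uΓ (A∥Γ (∧-separated {A} {B} {Γ} u))

  UniqueNames-∧ʳ : ∀ {A B Γ} → UniqueNames ((A ∧' B) ∷ Γ) → UniqueNames (B ∷ Γ)
  UniqueNames-∧ʳ {A} {B} {Γ} u with UniqueNames-∷⁻ {A ∧' B} {Γ} u
  ... | uAB , uΓ , _ = Unique-++⁺ (proj₁ (proj₂ (Unique-++⁻ (names A) uAB))) uΓ (B∥Γ (∧-separated {A} {B} {Γ} u))

  ∈-namesΓ-∧ : ∀ A B Γ {z} → (z ∈ namesΓ ((A ∧' B) ∷ Γ)) ⟺ (z ∈ namesΓ (A ∷ Γ) ⊎ z ∈ namesΓ (B ∷ Γ))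
  ∈-namesΓ-∧ A B Γ =
    (λ p → [ (λ q → [ (λ w → inj₁ (∈-++⁺ˡ w)) , (λ w → inj₂ (∈-++⁺ˡ w)) ]′ (∈-++⁻ (names A) q))
             , (λ q → inj₁ (∈-++⁺ʳ (names A) q)) ]′ (∈-++⁻ (names A ++ names B) p)) ,
    [ (λ p → [ (λ q → ∈-++⁺ˡ (∈-++⁺ˡ q)) , ∈-++⁺ʳ (names A ++ names B) ]′ (∈-++⁻ (names A) p)) ,
      (λ p → [ (λ q → ∈-++⁺ˡ (∈-++⁺ʳ (names A) q)) , ∈-++⁺ʳ (names A ++ names B) ]′ (∈-++⁻ (names B) p)) ]′

  OccΓ-∧ˡ⁺ : ∀ {A B Γ x a} → OccΓ (A ∷ Γ) x a → OccΓ ((A ∧' B) ∷ Γ) x a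
  OccΓ-∧ˡ⁺ (here p) = here (occ-∧ˡ p)
  OccΓ-∧ˡ⁺ (there q) = there q

  OccΓ-∧ʳ⁺ : ∀ {A B Γ x a} → OccΓ (B ∷ Γ) x a → OccΓ ((A ∧' B) ∷ Γ) x a
  OccΓ-∧ʳ⁺ (here p) = here (occ-∧ʳ p)
  OccΓ-∧ʳ⁺ (there q) = there q

  OccΓ-∧ˡ⁻ : ∀ {A B Γ x a} → OccΓ ((A ∧' B) ∷ Γ) x a → x ∉ names B → OccΓ (A ∷ Γ) x a
  OccΓ-∧ˡ⁻ (here (occ-∧ˡ p)) _ = here p
  OccΓ-∧ˡ⁻ (here (occ-∧ʳ p)) x∉ = ⊥-elim (x∉ (Occ⇒∈ p))
  OccΓ-∧ˡ⁻ (there q) _ = there q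

  OccΓ-∧ʳ⁻ : ∀ {A B Γ x a} → OccΓ ((A ∧' B) ∷ Γ) x a → x ∉ names A → OccΓ (B ∷ Γ) x a
  OccΓ-∧ʳ⁻ (here (occ-∧ˡ p)) x∉ = ⊥-elim (x∉ (Occ⇒∈ p))
  OccΓ-∧ʳ⁻ (here (occ-∧ʳ p)) _ = here p
  OccΓ-∧ʳ⁻ (there q) _ = there q

  BrΓ-∧ˡ⁺ : ∀ {A B Γ X} → ∧-Separated A B Γ → BrΓ (A ∷ Γ) X → BrΓ ((A ∧' B) ∷ Γ) X
  BrΓ-∧ˡ⁺ {A} {B} {Γ} {X} sep (s , (Y , b , e) ∷ r) =
    (λ z p → proj₂ (∈-namesΓ-∧ A B Γ) (inj₁ (s z p))) , (Y , inj₁ b , e′) ∷ r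
    where
    e′ : Y ≐ (λ z → z ∈ X × z ∈ names A ++ names B)
    e′ z = (λ p → let (x₁ , x₂) = proj₁ (e z) p in x₁ , ∈-++⁺ˡ x₂) ,
           (λ (x₁ , x₂) → [ (λ q → proj₂ (e z) (x₁ , q))
                          , (λ q → ⊥-elim ([ (λ w → A∥B sep z w q) , (λ w → B∥Γ sep z q w) ]′ (∈-++⁻ (names A) (s z x₁)))) ]′
                            (∈-++⁻ (names A) x₂))

  BrΓ-∧ʳ⁺ : ∀ {A B Γ X} → ∧-Separated A B Γ → BrΓ (B ∷ Γ) X → BrΓ ((A ∧' B) ∷ Γ) X
  BrΓ-∧ʳ⁺ {A} {B} {Γ} {X} sep (s , (Y , b , e) ∷ r) =
    (λ z p → proj₂ (∈-namesΓ-∧ A B Γ) (inj₂ (s z p))) , (Y , inj₂ b , e′) ∷ r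
    where
    e′ : Y ≐ (λ z → z ∈ X × z ∈ names A ++ names B)
    e′ z = (λ p → let (x₁ , x₂) = proj₁ (e z) p in x₁ , ∈-++⁺ʳ (names A) x₂) ,
           (λ (x₁ , x₂) → [ (λ q → ⊥-elim ([ (λ w → A∥B sep z q w) , (λ w → A∥Γ sep z q w) ]′ (∈-++⁻ (names B) (s z x₁))))
                          , (λ q → proj₂ (e z) (x₁ , q)) ]′
                            (∈-++⁻ (names A) x₂))

  BrΓ-∧⁻ : ∀ {A B Γ X} → ∧-Separated A B Γ → BrΓ ((A ∧' B) ∷ Γ) X → BrΓ (A ∷ Γ) X ⊎ BrΓ (B ∷ Γ) X
  BrΓ-∧⁻ {A} {B} {Γ} {X} sep (s , (Y , inj₁ b , e) ∷ r) = inj₁ (s′ , (Y , b , e′) ∷ r)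
    where
    s′ : ∀ z → z ∈ X → z ∈ namesΓ (A ∷ Γ)
    s′ z p with ∈-++⁻ (names A ++ names B) (s z p)
    ... | inj₂ q = ∈-++⁺ʳ (names A) q
    ... | inj₁ q = ∈-++⁺ˡ (InBr-⊆ b (proj₂ (e z) (p , q)))
    e′ : Y ≐ (λ z → z ∈ X × z ∈ names A)
    e′ z = (λ p → proj₁ (proj₁ (e z) p) , InBr-⊆ b p) , (λ (x₁ , x₂) → proj₂ (e z) (x₁ , ∈-++⁺ˡ x₂))
  BrΓ-∧⁻ {A} {B} {Γ} {X} sep (s , (Y , inj₂ b , e) ∷ r) = inj₂ (s′ , (Y , b , e′) ∷ r)
    where
    s′ : ∀ z → z ∈ X → z ∈ namesΓ (B ∷ Γ)
    s′ z p with ∈-++⁻ (names A ++ names B) (s z p)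
    ... | inj₂ q = ∈-++⁺ʳ (names B) q
    ... | inj₁ q = ∈-++⁺ˡ (InBr-⊆ b (proj₂ (e z) (p , q)))
    e′ : Y ≐ (λ z → z ∈ X × z ∈ names B)
    e′ z = (λ p → proj₁ (proj₁ (e z) p) , InBr-⊆ b p) , (λ (x₁ , x₂) → proj₂ (e z) (x₁ , ∈-++⁺ʳ (names A) x₂))

  Correct-∧ : ∀ {A B Γ G H} → UniqueNames ((A ∧' B) ∷ Γ) → Correct (A ∷ Γ) G → Correct (B ∷ Γ) H →
              Correct ((A ∧' B) ∷ Γ) (G ⊔ H)
  Correct-∧ {A} {B} {Γ} u C D = record
    { vertices = λ z →
        (λ p → proj₂ (∈-namesΓ-∧ A B Γ) ([ (λ q → inj₁ (proj₁ (vertices C z) q)) , (λ q → inj₂ (proj₁ (vertices D z) q)) ]′ p)) ,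
        (λ p → [ (λ q → inj₁ (proj₂ (vertices C z) q)) , (λ q → inj₂ (proj₂ (vertices D z) q)) ]′ (proj₁ (∈-namesΓ-∧ A B Γ) p))
    ; label-branch = [ (λ p → BrΓ-∧ˡ⁺ sep (label-branch C p)) , (λ p → BrΓ-∧ʳ⁺ sep (label-branch D p)) ]′
    ; ends-in-label = [ ends-in-label C , ends-in-label D ]′
    ; complementary = [ (λ p → let (a , q , r) = complementary C p in a , OccΓ-∧ˡ⁺ q , OccΓ-∧ˡ⁺ r)
                      , (λ p → let (a , q , r) = complementary D p in a , OccΓ-∧ʳ⁺ q , OccΓ-∧ʳ⁺ r) ]′
    ; edge-sym = λ { (inj₁ p) → inj₁ (edge-sym C p) ; (inj₂ p) → inj₂ (edge-sym D p) }
    ; edge-resp = λ { (inj₁ p) q → inj₁ (edge-resp C p q) ; (inj₂ p) q → inj₂ (edge-resp D p q) }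
    ; covers = λ b → [ (λ c → let (x , y , p) = covers C c in x , y , inj₁ p)
                     , (λ c → let (x , y , p) = covers D c in x , y , inj₂ p) ]′ (BrΓ-∧⁻ sep b)
    ; edge? = λ x y X → edge? C x y X ⊎-dec edge? D x y X }
    where
    sep = ∧-separated {A} {B} {Γ} u

  restrict : List Formula → BLGraph → BLGraph
  restrict Δ G = record { V = λ z → z ∈ namesΓ Δ ; E = λ x y X → E G x y X × BrΓ Δ X }

  Correct-restrict : ∀ {Γ Δ G} → UniqueNames Δ → (∀ {X} → BrΓ Δ X → BrΓ Γ X) →
    (∀ {x a} → OccΓ Γ x a → x ∈ namesΓ Δ → OccΓ Δ x a) → Correct Γ G → Correct Δ (restrict Δ G)
  Correct-restrict {Δ = Δ} u br occ-Δ C = record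
    { vertices = λ z → (λ p → p) , (λ p → p)
    ; label-branch = proj₂
    ; ends-in-label = λ (p , _) → ends-in-label C p
    ; complementary = λ (p , b) → let (a , q , r) = complementary C p ; (x∈ , y∈) = ends-in-label C p in
                                  a , occ-Δ q (BrΓ-⊆ b x∈) , occ-Δ r (BrΓ-⊆ b y∈)
    ; edge-sym = λ (p , b) → edge-sym C p , b
    ; edge-resp = λ (p , b) e → edge-resp C p e , BrΓ-resp b e
    ; covers = λ b → let (x , y , p) = covers C (br b) in x , y , p , b
    ; edge? = λ x y X → edge? C x y X ×-dec BrΓ-dec Δ u X }

  Correct-restrict-∧ˡ : ∀ {A B Γ G} → UniqueNames ((A ∧' B) ∷ Γ) → Correct ((A ∧' B) ∷ Γ) G →
                        Correct (A ∷ Γ) (restrict (A ∷ Γ) G)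
  Correct-restrict-∧ˡ {A} {B} {Γ} u = Correct-restrict (UniqueNames-∧ˡ {A} {B} {Γ} u) (BrΓ-∧ˡ⁺ sep)
    (λ q x∈ → OccΓ-∧ˡ⁻ q λ x∈B → [ (λ w → A∥B sep _ w x∈B) , (λ w → B∥Γ sep _ x∈B w) ]′ (∈-++⁻ (names A) x∈))
    where
    sep = ∧-separated {A} {B} {Γ} u

  Correct-restrict-∧ʳ : ∀ {A B Γ G} → UniqueNames ((A ∧' B) ∷ Γ) → Correct ((A ∧' B) ∷ Γ) G →
                        Correct (B ∷ Γ) (restrict (B ∷ Γ) G)
  Correct-restrict-∧ʳ {A} {B} {Γ} u = Correct-restrict (UniqueNames-∧ʳ {A} {B} {Γ} u) (BrΓ-∧ʳ⁺ sep)
    (λ q x∈ → OccΓ-∧ʳ⁻ q λ x∈A → [ (λ w → A∥B sep _ x∈A w) , (λ w → A∥Γ sep _ x∈A w) ]′ (∈-++⁻ (names B) x∈))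
    where
    sep = ∧-separated {A} {B} {Γ} u

  restrict-∧-split : ∀ {A B Γ G} → UniqueNames ((A ∧' B) ∷ Γ) → Correct ((A ∧' B) ∷ Γ) G →
                     G ≅ (restrict (A ∷ Γ) G ⊔ restrict (B ∷ Γ) G)
  restrict-∧-split {A} {B} {Γ} u C =
    (λ z → (λ p → proj₁ (∈-namesΓ-∧ A B Γ) (proj₁ (vertices C z) p)) ,
           (λ p → proj₂ (vertices C z) (proj₂ (∈-namesΓ-∧ A B Γ) p))) ,
    (λ x y X → (λ p → [ (λ b → inj₁ (p , b)) , (λ b → inj₂ (p , b)) ]′ (BrΓ-∧⁻ (∧-separated {A} {B} {Γ} u) (label-branch C p))) ,
               [ proj₁ , proj₁ ]′)

  BrΓ-++⁺ : ∀ {Δ Γ X Y Z} → Disjoint (namesΓ Δ) (namesΓ Γ) → BrΓ Δ X → BrΓ Γ Y →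
            Z ≐ (λ z → z ∈ X ⊎ z ∈ Y) → BrΓ (Δ ++ Γ) Z
  BrΓ-++⁺ {Δ} {Γ} d (s , al) (t , bl) e =
    (λ z p → ∈-namesΓ-++⁺ Δ Γ ([ (λ q → inj₁ (s z q)) , (λ q → inj₂ (t z q)) ]′ (proj₁ (e z) p))) ,
    All.tabulate (λ m → [ (λ mΔ → BranchAt-resp (λ z _ q → proj₂ (e z) (inj₁ q))
                            (λ z zA q → [ (λ w → w) , (λ w → ⊥-elim (d z (∈-namesΓ⁺ mΔ zA) (t z w))) ]′ (proj₁ (e z) q))
                            (All.lookup al mΔ))
                        , (λ mΓ → BranchAt-resp (λ z _ q → proj₂ (e z) (inj₂ q))
                            (λ z zA q → [ (λ w → ⊥-elim (d z (s z w) (∈-namesΓ⁺ mΓ zA))) , (λ w → w) ]′ (proj₁ (e z) q))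
                            (All.lookup bl mΓ)) ]′
                        (∈-++⁻ Δ m))

  BrΓ-++⁻ : ∀ {Δ Γ Z} → BrΓ (Δ ++ Γ) Z →
            BrΓ Δ (Z ∩ namesΓ Δ) × BrΓ Γ (Z ∩ namesΓ Γ) × Z ≐ (λ z → z ∈ Z ∩ namesΓ Δ ⊎ z ∈ Z ∩ namesΓ Γ)
  BrΓ-++⁻ {Δ} {Γ} {Z} (s , al) =
    part Δ (λ m → All.lookup al (∈-++⁺ˡ m)) , part Γ (λ m → All.lookup al (∈-++⁺ʳ Δ m)) ,
    (λ z → (λ p → [ (λ q → inj₁ (∈-∩⁺ p q)) , (λ q → inj₂ (∈-∩⁺ p q)) ]′ (∈-namesΓ-++⁻ Δ Γ (s z p))) ,
           [ (λ q → proj₁ (∈-∩⁻ q)) , (λ q → proj₁ (∈-∩⁻ q)) ]′)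
    where
    part : ∀ Θ → (∀ {A} → A ∈ Θ → BranchAt Z A) → BrΓ Θ (Z ∩ namesΓ Θ)
    part Θ f = (λ z p → proj₂ (∈-∩⁻ {Z} p)) ,
               All.tabulate (λ m → BranchAt-resp (λ z zA q → ∈-∩⁺ q (∈-namesΓ⁺ m zA)) (λ z _ q → proj₁ (∈-∩⁻ q)) (f m))

  OccΓ-++ˡ : ∀ {Δ Γ x a} → OccΓ Δ x a → OccΓ (Δ ++ Γ) x a
  OccΓ-++ˡ p = let (A , m , q) = find p in lose (∈-++⁺ˡ m) q

  Correct-wk : ∀ {Δ Γ G} → UniqueNames (Δ ++ Γ) → Correct Δ G → Correct (Δ ++ Γ) (wk Γ G)
  Correct-wk {Δ} {Γ} {G} u C = record
    { vertices = λ z → [ (λ p → ∈-namesΓ-++⁺ Δ Γ (inj₁ (proj₁ (vertices C z) p))) , (λ p → ∈-namesΓ-++⁺ Δ Γ (inj₂ p)) ]′ ,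
                       (λ p → [ (λ q → inj₁ (proj₂ (vertices C z) q)) , inj₂ ]′ (∈-namesΓ-++⁻ Δ Γ p))
    ; label-branch = λ (_ , _ , p , b , e) → BrΓ-++⁺ d (label-branch C p) b e
    ; ends-in-label = λ (_ , _ , p , b , e) → let (x∈ , y∈) = ends-in-label C p in
                                             proj₂ (e _) (inj₁ x∈) , proj₂ (e _) (inj₁ y∈)
    ; complementary = λ (_ , _ , p , b , e) → let (a , q , r) = complementary C p in a , OccΓ-++ˡ q , OccΓ-++ˡ r
    ; edge-sym = λ (X , Y , p , b , e) → X , Y , edge-sym C p , b , e
    ; edge-resp = λ (X , Y , p , b , e) q → X , Y , p , b , ≐-respˡ (≈-sym q) e
    ; covers = λ b → let (b₁ , b₂ , e) = BrΓ-++⁻ {Δ} {Γ} b ; (x , y , p) = covers C b₁ in x , y , _ , _ , p , b₂ , e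
    ; edge? = λ x y Z → map′ (to x y Z) (from x y Z)
        (edge? C x y (Z ∩ namesΓ Δ) ×-dec BrΓ-dec Γ uΓ (Z ∩ namesΓ Γ) ×-dec Z ⊆? namesΓ Δ ++ namesΓ Γ) }
    where
    uΓ = proj₁ (proj₂ (UniqueNames-++⁻ Δ Γ u))
    d = proj₂ (proj₂ (UniqueNames-++⁻ Δ Γ u))
    to : ∀ x y Z → E G x y (Z ∩ namesΓ Δ) × BrΓ Γ (Z ∩ namesΓ Γ) × Z ⊆ namesΓ Δ ++ namesΓ Γ → E (wk Γ G) x y Z
    to x y Z (p , b , s) =
      _ , _ , p , b , λ z → (λ q → [ (λ w → inj₁ (∈-∩⁺ q w)) , (λ w → inj₂ (∈-∩⁺ q w)) ]′ (∈-++⁻ (namesΓ Δ) (s q))) ,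
                            [ (λ q → proj₁ (∈-∩⁻ q)) , (λ q → proj₁ (∈-∩⁻ q)) ]′
    from : ∀ x y Z → E (wk Γ G) x y Z → E G x y (Z ∩ namesΓ Δ) × BrΓ Γ (Z ∩ namesΓ Γ) × Z ⊆ namesΓ Δ ++ namesΓ Γ
    from x y Z (X , Y , p , b , e) with split-≈ (BrΓ-⊆ (label-branch C p)) (BrΓ-⊆ b) d e
    ... | e₁ , e₂ = edge-resp C p e₁ , BrΓ-resp b e₂ ,
                    λ q → [ (λ w → ∈-++⁺ˡ (BrΓ-⊆ (label-branch C p) w)) , (λ w → ∈-++⁺ʳ (namesΓ Δ) (BrΓ-⊆ b w)) ]′ (proj₁ (e _) q)

  Correct-idAt : ∀ {a c x y} → c ≡ bar a → x ≢ y → Correct (at a x ∷ at c y ∷ []) (idAt x y)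
  Correct-idAt {a} {c} {x} {y} refl x≢y = record
    { vertices = λ z → [ (λ { refl → here refl }) , (λ { refl → there (here refl) }) ]′ ,
                       (λ { (here q) → inj₁ q ; (there (here q)) → inj₂ q })
    ; label-branch = λ (_ , e) → branch e
    ; ends-in-label = λ { (inj₁ (refl , refl) , e) → proj₂ (e _) (inj₁ refl) , proj₂ (e _) (inj₂ refl)
                        ; (inj₂ (refl , refl) , e) → proj₂ (e _) (inj₂ refl) , proj₂ (e _) (inj₁ refl) }
    ; complementary = λ { (inj₁ (refl , refl) , _) → comp ; (inj₂ (refl , refl) , _) → Complementary-sym comp }
    ; edge-sym = λ { (inj₁ (refl , refl) , e) → inj₂ (refl , refl) , e ; (inj₂ (refl , refl) , e) → inj₁ (refl , refl) , e }
    ; edge-resp = λ (o , e) q → o , ≐-respˡ (≈-sym q) e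
    ; covers = λ b → x , y , inj₁ (refl , refl) , cover b
    ; edge? = λ x′ y′ X → ((x′ ≟ x ×-dec y′ ≟ y) ⊎-dec (x′ ≟ y ×-dec y′ ≟ x)) ×-dec
                          map′ (λ e → ≐-respʳ e pair) (λ e → ≐-respʳ e (λ z → proj₂ (pair z) , proj₁ (pair z))) (≈? X (x ∷ y ∷ [])) }
    where
    Γ = at a x ∷ at (bar a) y ∷ []
    pair : ∀ z → (z ∈ x ∷ y ∷ []) ⟺ (z ≡ x ⊎ z ≡ y)
    pair z = (λ { (here q) → inj₁ q ; (there (here q)) → inj₂ q }) , [ here , (λ q → there (here q)) ]′
    comp : Complementary Γ x y
    comp = a , here occ , there (here occ)
    singleton : ∀ {X b} v → v ∈ X → BranchAt X (at b v)
    singleton v v∈ = v ∷ [] , (λ z → (λ { (here q) → q }) , here) ,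
                     (λ z → (λ { (here refl) → v∈ , here refl }) , (λ { (_ , here q) → here q }))
    branch : ∀ {X} → X ≐ (λ z → z ≡ x ⊎ z ≡ y) → BrΓ Γ X
    branch e = (λ z p → proj₂ (pair z) (proj₁ (e z) p)) ,
               singleton {b = a} x (proj₂ (e x) (inj₁ refl)) ∷ singleton {b = bar a} y (proj₂ (e y) (inj₂ refl)) ∷ []
    cover : ∀ {X} → BrΓ Γ X → X ≐ (λ z → z ≡ x ⊎ z ≡ y)
    cover (s , (_ , b₁ , e₁) ∷ (_ , b₂ , e₂) ∷ []) z =
      (λ p → proj₁ (pair z) (s z p)) ,
      [ (λ { refl → proj₁ (proj₁ (e₁ x) (proj₂ (b₁ x) refl)) }) , (λ { refl → proj₁ (proj₁ (e₂ y) (proj₂ (b₂ y) refl)) }) ]′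

  Correct-id-∨∧ : ∀ {A₁ A₂ C₁ C₂ G₁ G₂} → UniqueNames ((A₁ ∨' A₂) ∷ (C₁ ∧' C₂) ∷ []) →
    Correct (A₁ ∷ C₁ ∷ []) G₁ → Correct (A₂ ∷ C₂ ∷ []) G₂ →
    Correct ((A₁ ∨' A₂) ∷ (C₁ ∧' C₂) ∷ []) (wk (A₂ ∷ []) G₁ ⊔ wk (A₁ ∷ []) G₂)
  Correct-id-∨∧ {A₁} {A₂} {C₁} {C₂} {G₁} {G₂} u C D with UniqueNames⇒SharingFree {(A₁ ∨' A₂) ∷ (C₁ ∧' C₂) ∷ []} u
  ... | uA ∷ uC ∷ [] , (d ∷ []) ∷ [] ∷ [] with Unique-++⁻ (names A₁) uA | Unique-++⁻ (names C₁) uC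
  ... | uA₁ , uA₂ , dA | uC₁ , uC₂ , _ =
    Correct-∨⁺ u (Correct-≋ rotate (Correct-∧ (SharingFree⇒UniqueNames {(C₁ ∧' C₂) ∷ A₁ ∷ A₂ ∷ []} sf-∧) C′ D′))
    where
    d₁₁ = Disjoint-mono d ∈-++⁺ˡ ∈-++⁺ˡ
    d₁₂ = Disjoint-mono d ∈-++⁺ˡ (∈-++⁺ʳ (names C₁))
    d₂₁ = Disjoint-mono d (∈-++⁺ʳ (names A₁)) ∈-++⁺ˡ
    d₂₂ = Disjoint-mono d (∈-++⁺ʳ (names A₁)) (∈-++⁺ʳ (names C₁))
    sf-∧ : SharingFree ((C₁ ∧' C₂) ∷ A₁ ∷ A₂ ∷ [])
    sf-∧ = uC ∷ uA₁ ∷ uA₂ ∷ [] ,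
           ((λ z p q → d z (∈-++⁺ˡ q) p) ∷ (λ z p q → d z (∈-++⁺ʳ (names A₁) q) p) ∷ []) ∷ (dA ∷ []) ∷ [] ∷ []
    sf₁ : SharingFree (A₁ ∷ C₁ ∷ A₂ ∷ [])
    sf₁ = uA₁ ∷ uC₁ ∷ uA₂ ∷ [] , (d₁₁ ∷ dA ∷ []) ∷ (Disjoint-sym d₂₁ ∷ []) ∷ [] ∷ []
    sf₂ : SharingFree (A₂ ∷ C₂ ∷ A₁ ∷ [])
    sf₂ = uA₂ ∷ uC₂ ∷ uA₁ ∷ [] , (d₂₂ ∷ Disjoint-sym dA ∷ []) ∷ (Disjoint-sym d₁₂ ∷ []) ∷ [] ∷ []
    C′ : Correct (C₁ ∷ A₁ ∷ A₂ ∷ []) (wk (A₂ ∷ []) G₁)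
    C′ = Correct-≋ swap₁₂ (Correct-wk (SharingFree⇒UniqueNames {A₁ ∷ C₁ ∷ A₂ ∷ []} sf₁) C)
      where
      swap₁₂ : (A₁ ∷ C₁ ∷ A₂ ∷ []) ≋ (C₁ ∷ A₁ ∷ A₂ ∷ [])
      swap₁₂ _ = (λ { (here refl) → there (here refl) ; (there (here refl)) → here refl ; (there (there m)) → there (there m) })
               , (λ { (here refl) → there (here refl) ; (there (here refl)) → here refl ; (there (there m)) → there (there m) })
    D′ : Correct (C₂ ∷ A₁ ∷ A₂ ∷ []) (wk (A₁ ∷ []) G₂)
    D′ = Correct-≋ rotate′ (Correct-wk (SharingFree⇒UniqueNames {A₂ ∷ C₂ ∷ A₁ ∷ []} sf₂) D)
      where
      rotate′ : (A₂ ∷ C₂ ∷ A₁ ∷ []) ≋ (C₂ ∷ A₁ ∷ A₂ ∷ [])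
      rotate′ _ = (λ { (here refl) → there (there (here refl)) ; (there (here refl)) → here refl ; (there (there (here refl))) → there (here refl) })
                , (λ { (here refl) → there (here refl) ; (there (here refl)) → there (there (here refl)) ; (there (there (here refl))) → here refl })
    rotate : ((C₁ ∧' C₂) ∷ A₁ ∷ A₂ ∷ []) ≋ (A₁ ∷ A₂ ∷ (C₁ ∧' C₂) ∷ [])
    rotate _ = (λ { (here refl) → there (there (here refl)) ; (there (here refl)) → here refl ; (there (there (here refl))) → there (here refl) })
             , (λ { (here refl) → there (here refl) ; (there (here refl)) → there (there (here refl)) ; (there (there (here refl))) → here refl })

  ∨-shape-injective : ∀ {s₁ s₂ t₁ t₂ : Shape} → (s₁ ∨' s₂) ≡ (t₁ ∨' t₂) → s₁ ≡ t₁ × s₂ ≡ t₂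
  ∨-shape-injective refl = refl , refl

  ∧-shape-injective : ∀ {s₁ s₂ t₁ t₂ : Shape} → (s₁ ∧' s₂) ≡ (t₁ ∧' t₂) → s₁ ≡ t₁ × s₂ ≡ t₂
  ∧-shape-injective refl = refl , refl

  UniqueNames-pair : ∀ A B → SharingFreeF A → SharingFreeF B → Disjoint (names A) (names B) → UniqueNames (A ∷ B ∷ [])
  UniqueNames-pair A B uA uB d = SharingFree⇒UniqueNames {A ∷ B ∷ []} (uA ∷ uB ∷ [] , (d ∷ []) ∷ [] ∷ [])

  -- Both orientations at once, since idG (A₁ ∧' A₂) (C₁ ∨' C₂) is built from idG C₁ A₁ and idG C₂ A₂.
  Correct-id : ∀ A B → erase A ≡ erase B → UniqueNames (A ∷ neg B ∷ []) →
               Correct (A ∷ neg B ∷ []) (idG A (neg B)) × Correct (neg B ∷ A ∷ []) (idG (neg B) A)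
  Correct-id (at a x) (at .a y) refl u with UniqueNames⇒SharingFree {at a x ∷ at (bar a) y ∷ []} u
  ... | _ , (d ∷ []) ∷ [] ∷ [] =
    Correct-idAt refl (λ e → d x (here refl) (here e)) ,
    Correct-idAt (sym (bar-involutive a)) (λ e → d x (here refl) (here (sym e)))
  Correct-id (A₁ ∨' A₂) (B₁ ∨' B₂) eq u with ∨-shape-injective eq
  ... | e₁ , e₂ with UniqueNames⇒SharingFree {(A₁ ∨' A₂) ∷ (neg B₁ ∧' neg B₂) ∷ []} u
  ... | uA ∷ uC ∷ [] , (d ∷ []) ∷ [] ∷ [] with Unique-++⁻ (names A₁) uA | Unique-++⁻ (names (neg B₁)) uC
  ... | uA₁ , uA₂ , _ | uC₁ , uC₂ , _ = R , Correct-≋ swap R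
    where
    R = Correct-id-∨∧ u
          (proj₁ (Correct-id A₁ B₁ e₁ (UniqueNames-pair A₁ (neg B₁) uA₁ uC₁ (Disjoint-mono d ∈-++⁺ˡ ∈-++⁺ˡ))))
          (proj₁ (Correct-id A₂ B₂ e₂ (UniqueNames-pair A₂ (neg B₂) uA₂ uC₂
            (Disjoint-mono d (∈-++⁺ʳ (names A₁)) (∈-++⁺ʳ (names (neg B₁)))))))
    swap : ((A₁ ∨' A₂) ∷ (neg B₁ ∧' neg B₂) ∷ []) ≋ ((neg B₁ ∧' neg B₂) ∷ (A₁ ∨' A₂) ∷ [])
    swap _ = (λ { (here refl) → there (here refl) ; (there (here refl)) → here refl })
           , (λ { (here refl) → there (here refl) ; (there (here refl)) → here refl })
  Correct-id (A₁ ∧' A₂) (B₁ ∧' B₂) eq u with ∧-shape-injective eq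
  ... | e₁ , e₂ with UniqueNames⇒SharingFree {(A₁ ∧' A₂) ∷ (neg B₁ ∨' neg B₂) ∷ []} u
  ... | uA ∷ uC ∷ [] , (d ∷ []) ∷ [] ∷ [] with Unique-++⁻ (names A₁) uA | Unique-++⁻ (names (neg B₁)) uC
  ... | uA₁ , uA₂ , _ | uC₁ , uC₂ , _ = Correct-≋ swap R , R
    where
    R = Correct-id-∨∧ (UniqueNames-pair (neg B₁ ∨' neg B₂) (A₁ ∧' A₂) uC uA (Disjoint-sym d))
          (proj₂ (Correct-id A₁ B₁ e₁ (UniqueNames-pair A₁ (neg B₁) uA₁ uC₁ (Disjoint-mono d ∈-++⁺ˡ ∈-++⁺ˡ))))
          (proj₂ (Correct-id A₂ B₂ e₂ (UniqueNames-pair A₂ (neg B₂) uA₂ uC₂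
            (Disjoint-mono d (∈-++⁺ʳ (names A₁)) (∈-++⁺ʳ (names (neg B₁)))))))
    swap : ((neg B₁ ∨' neg B₂) ∷ (A₁ ∧' A₂) ∷ []) ≋ ((A₁ ∧' A₂) ∷ (neg B₁ ∨' neg B₂) ∷ [])
    swap _ = (λ { (here refl) → there (here refl) ; (there (here refl)) → here refl })
           , (λ { (here refl) → there (here refl) ; (there (here refl)) → here refl })
  Correct-id (at _ _) (_ ∨' _) () u
  Correct-id (at _ _) (_ ∧' _) () u
  Correct-id (_ ∨' _) (at _ _) () u
  Correct-id (_ ∨' _) (_ ∧' _) () u
  Correct-id (_ ∧' _) (at _ _) () u
  Correct-id (_ ∧' _) (_ ∨' _) () u

  Realized : List Formula → BLGraph → Set
  Realized Γ G = Σ (Deriv Γ) λ Q → CutFree Q × (G ≅ ⟪ Q ⟫)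

  IsAtomic : Formula → Set
  IsAtomic F = ∃₂ λ a x → F ≡ at a x

  atomic-branch⇒ : ∀ {Γ Z} → All IsAtomic Γ → BrΓ Γ Z → Z ≈ namesΓ Γ
  atomic-branch⇒ {Γ} atomic (s , al) z = s z , λ p → component p
    where
    component : z ∈ namesΓ Γ → z ∈ _
    component p with ∈-namesΓ⁻ Γ p
    ... | F , m , q with All.lookup atomic m | All.lookup al m
    ... | a , x , refl | Y , b , e with q
    ... | here refl = proj₁ (proj₁ (e x) (proj₂ (b x) refl))

  atomic-branch⇐ : ∀ {Γ Z} → All IsAtomic Γ → Z ≈ namesΓ Γ → BrΓ Γ Z
  atomic-branch⇐ {Γ} {Z} atomic e = (λ z → proj₁ (e z)) , All.tabulate component
    where
    component : ∀ {F} → F ∈ Γ → BranchAt Z F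
    component m with All.lookup atomic m
    ... | a , x , refl = x ∷ [] , (λ z → (λ { (here q) → q }) , here) ,
          (λ z → (λ { (here refl) → proj₂ (e x) (∈-namesΓ⁺ m (here refl)) , here refl }) , (λ { (_ , here q) → here q }))

  Avoids : Name → Name → Formula → Set
  Avoids x y F = x ∉ names F × y ∉ names F

  avoids? : ∀ x y F → Dec (Avoids x y F)
  avoids? x y F = ¬? (x ∈? names F) ×-dec ¬? (y ∈? names F)

  others : Name → Name → List Formula → List Formula
  others x y = filter (avoids? x y)

  ∈-others⁻ : ∀ {x y Γ F} → F ∈ others x y Γ → F ∈ Γ × Avoids x y F
  ∈-others⁻ {x} {y} = ∈-filter⁻ (avoids? x y)

  ∈-others⁺ : ∀ {x y Γ F} → F ∈ Γ → Avoids x y F → F ∈ others x y Γ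
  ∈-others⁺ {x} {y} = ∈-filter⁺ (avoids? x y)

  UniqueNames-others : ∀ x y Γ → UniqueNames Γ → UniqueNames (others x y Γ)
  UniqueNames-others x y [] u = u
  UniqueNames-others x y (F ∷ Γ) u with UniqueNames-∷⁻ {F} {Γ} u | avoids? x y F
  ... | uF , uΓ , d | yes a =
    subst UniqueNames (sym (filter-accept (avoids? x y) {F} {Γ} a)) (UniqueNames-∷⁺ {F} {others x y Γ} uF (UniqueNames-others x y Γ uΓ)
      (λ z p q → let (G , m , r) = ∈-namesΓ⁻ (others x y Γ) q in d z p (∈-namesΓ⁺ (proj₁ (∈-others⁻ {x} {y} {Γ} m)) r)))
  ... | _ , uΓ , _ | no ¬a = subst UniqueNames (sym (filter-reject (avoids? x y) {F} {Γ} ¬a)) (UniqueNames-others x y Γ uΓ)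

  -- For an atomic sequent, the correct graph is the superposition of one axiom per edge.
  module Atomic {Γ G} (u : UniqueNames Γ) (atomic : All IsAtomic Γ) (C : Correct Γ G) where

    N : List Name
    N = namesΓ Γ

    atom-∈ : ∀ {x a} → OccΓ Γ x a → at a x ∈ Γ
    atom-∈ p with find p
    ... | F , m , q with All.lookup atomic m
    ... | b , z , refl with q
    ... | occ = m

    module Axiom (x y : Name) (p : E G x y N) where
      a : Atom
      a = proj₁ (complementary C p)
      R : List Formula
      R = others x y Γ
      L : List Formula
      L = at a x ∷ at (bar a) y ∷ R

      Γ≋L : Γ ≋ L
      Γ≋L F = to , from
        where
        px = proj₁ (proj₂ (complementary C p))
        py = proj₂ (proj₂ (complementary C p))
        to : F ∈ Γ → F ∈ L
        to m with x ∈? names F | y ∈? names F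
        ... | no x∉ | no y∉ = there (there (∈-others⁺ {x} {y} {Γ} m (x∉ , y∉)))
        ... | yes x∈ | _ with All.lookup atomic m
        ... | b , z , refl with x∈
        ... | here refl = subst (λ c → at c x ∈ L) (OccΓ-functional u px (lose m occ)) (here refl)
        to m | no _ | yes y∈ with All.lookup atomic m
        ... | b , z , refl with y∈
        ... | here refl = subst (λ c → at c y ∈ L) (OccΓ-functional u py (lose m occ)) (there (here refl))
        from : F ∈ L → F ∈ Γ
        from (here refl) = atom-∈ px
        from (there (here refl)) = atom-∈ py
        from (there (there m)) = proj₁ (∈-others⁻ {x} {y} {Γ} m)

      x≢y : x ≢ y
      x≢y = Complementary⇒≢ u (complementary C p)

      ∉-namesR : ∀ {z} → z ∈ namesΓ R → z ≢ x × z ≢ y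
      ∉-namesR q with ∈-namesΓ⁻ R q
      ... | F , m , r with ∈-others⁻ {x} {y} {Γ} m
      ... | _ , x∉ , y∉ = (λ { refl → x∉ r }) , (λ { refl → y∉ r })

      uL : UniqueNames L
      uL = UniqueNames-∷⁺ {at a x} {at (bar a) y ∷ R} ([] ∷ [])
             (UniqueNames-∷⁺ {at (bar a) y} {R} ([] ∷ []) (UniqueNames-others x y Γ u)
               (λ { z (here refl) q → proj₂ (∉-namesR q) refl }))
             (λ { z (here refl) (here e) → x≢y e ; z (here refl) (there q) → proj₁ (∉-namesR q) refl })

      axiom : Deriv Γ
      axiom = ax R (at a x) (at a y) refl (UniqueNames⇒SharingFree uL) Γ≋L

      ∈-N : ∀ z → (z ∈ N) ⟺ ((z ≡ x ⊎ z ≡ y) ⊎ z ∈ namesΓ R)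
      ∈-N z = (λ q → split (proj₁ (namesΓ-≋ Γ≋L z) q)) , (λ q → proj₂ (namesΓ-≋ Γ≋L z) (join q))
        where
        split : z ∈ namesΓ L → (z ≡ x ⊎ z ≡ y) ⊎ z ∈ namesΓ R
        split (here e) = inj₁ (inj₁ e)
        split (there (here e)) = inj₁ (inj₂ e)
        split (there (there q)) = inj₂ q
        join : (z ≡ x ⊎ z ≡ y) ⊎ z ∈ namesΓ R → z ∈ namesΓ L
        join (inj₁ (inj₁ e)) = here e
        join (inj₁ (inj₂ e)) = there (here e)
        join (inj₂ q) = there (there q)

      axiom-vertices : ∀ z → V ⟪ axiom ⟫ z ⟺ (z ∈ N)
      axiom-vertices z = proj₂ (∈-N z) , proj₁ (∈-N z)

      R-atomic : All IsAtomic R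
      R-atomic = All.tabulate (λ m → All.lookup atomic (proj₁ (∈-others⁻ {x} {y} {Γ} m)))

      axiom-edge⇒ : ∀ {v w Z} → E ⟪ axiom ⟫ v w Z → ((v ≡ x × w ≡ y) ⊎ (v ≡ y × w ≡ x)) × Z ≈ N
      axiom-edge⇒ (X , Y , (o , e₁) , b , e) = o , λ z →
        (λ q → proj₂ (∈-N z) ([ (λ r → inj₁ (proj₁ (e₁ z) r)) , (λ r → inj₂ (BrΓ-⊆ b r)) ]′ (proj₁ (e z) q))) ,
        (λ q → proj₂ (e z) ([ (λ s → inj₁ (proj₂ (e₁ z) s)) , (λ r → inj₂ (proj₂ (atomic-branch⇒ R-atomic b z) r)) ]′
                              (proj₁ (∈-N z) q)))

      axiom-edge⇐ : ∀ {v w Z} → (v ≡ x × w ≡ y) ⊎ (v ≡ y × w ≡ x) → Z ≈ N → E ⟪ axiom ⟫ v w Z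
      axiom-edge⇐ o e =
        x ∷ y ∷ [] , namesΓ R , (o , λ z → pair z) , atomic-branch⇐ R-atomic ≈-refl ,
        λ z → (λ q → [ (λ s → inj₁ (proj₂ (pair z) s)) , inj₂ ]′ (proj₁ (∈-N z) (proj₁ (e z) q))) ,
              (λ q → proj₂ (e z) (proj₂ (∈-N z) ([ (λ s → inj₁ (proj₁ (pair z) s)) , inj₂ ]′ q)))
        where
        pair : ∀ z → (z ∈ x ∷ y ∷ []) ⟺ (z ≡ x ⊎ z ≡ y)
        pair z = (λ { (here q) → inj₁ q ; (there (here q)) → inj₂ q }) , [ here , (λ q → there (here q)) ]′

      axiom-sound : ∀ {v w Z} → E ⟪ axiom ⟫ v w Z → E G v w Z
      axiom-sound q with axiom-edge⇒ q
      ... | inj₁ (refl , refl) , e = edge-resp C p (≈-sym e)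
      ... | inj₂ (refl , refl) , e = edge-sym C (edge-resp C p (≈-sym e))

    open Axiom using (axiom; axiom-vertices; axiom-edge⇐; axiom-sound)

    superpose : Deriv Γ → List (Name × Name) → Deriv Γ
    superpose D [] = D
    superpose D ((x , y) ∷ ps) with edge? C x y N
    ... | yes p = sup (UniqueNames⇒SharingFree u) (axiom x y p) (superpose D ps)
    ... | no _ = superpose D ps

    superpose-cut-free : ∀ {D} → CutFree D → ∀ ps → CutFree (superpose D ps)
    superpose-cut-free c [] = c
    superpose-cut-free c ((x , y) ∷ ps) with edge? C x y N
    ... | yes p = tt , superpose-cut-free c ps
    ... | no _ = superpose-cut-free c ps

    superpose-vertices : ∀ {D} → (∀ z → V ⟪ D ⟫ z ⟺ (z ∈ N)) → ∀ ps z → V ⟪ superpose D ps ⟫ z ⟺ (z ∈ N)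
    superpose-vertices h [] z = h z
    superpose-vertices h ((x , y) ∷ ps) z with edge? C x y N
    ... | yes p = [ proj₁ (axiom-vertices x y p z) , proj₁ (superpose-vertices h ps z) ]′ ,
                  (λ q → inj₂ (proj₂ (superpose-vertices h ps z) q))
    ... | no _ = superpose-vertices h ps z

    superpose-sound : ∀ {D} → (∀ {v w Z} → E ⟪ D ⟫ v w Z → E G v w Z) → ∀ ps {v w Z} →
                      E ⟪ superpose D ps ⟫ v w Z → E G v w Z
    superpose-sound s [] q = s q
    superpose-sound s ((x , y) ∷ ps) q with edge? C x y N
    superpose-sound s ((x , y) ∷ ps) (inj₁ q) | yes p = axiom-sound x y p q
    superpose-sound s ((x , y) ∷ ps) (inj₂ q) | yes p = superpose-sound s ps q
    ... | no _ = superpose-sound s ps q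

    superpose-complete : ∀ {D} ps {v w Z} → (v , w) ∈ ps → E G v w Z → E ⟪ superpose D ps ⟫ v w Z
    superpose-complete ((x , y) ∷ ps) m q with edge? C x y N
    superpose-complete ((x , y) ∷ ps) (here refl) q | yes p =
      inj₁ (axiom-edge⇐ x y p (inj₁ (refl , refl)) (atomic-branch⇒ atomic (label-branch C q)))
    superpose-complete ((x , y) ∷ ps) (there m) q | yes p = inj₂ (superpose-complete ps m q)
    superpose-complete ((x , y) ∷ ps) (here refl) q | no ¬p = ⊥-elim (¬p (edge-resp C q (atomic-branch⇒ atomic (label-branch C q))))
    superpose-complete ((x , y) ∷ ps) (there m) q | no ¬p = superpose-complete ps m q

    realize-atomic : Realized Γ G
    realize-atomic = Q , superpose-cut-free tt pairs , vertices≅ , edges≅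
      where
      first = covers C (atomic-branch⇐ atomic ≈-refl)
      x₀ = proj₁ first
      y₀ = proj₁ (proj₂ first)
      p₀ = proj₂ (proj₂ first)
      pairs = cartesianProduct N N
      Q = superpose (axiom x₀ y₀ p₀) pairs
      vertices≅ : ∀ z → V G z ⟺ V ⟪ Q ⟫ z
      vertices≅ z = (λ q → proj₂ (superpose-vertices (axiom-vertices x₀ y₀ p₀) pairs z) (proj₁ (vertices C z) q)) ,
                    (λ q → proj₂ (vertices C z) (proj₁ (superpose-vertices (axiom-vertices x₀ y₀ p₀) pairs z) q))
      edges≅ : ∀ v w Z → E G v w Z ⟺ E ⟪ Q ⟫ v w Z
      edges≅ v w Z =
        (λ q → let (v∈ , w∈) = ends-in-label C q ; b = label-branch C q in
               superpose-complete pairs (∈-cartesianProduct⁺ (BrΓ-⊆ b v∈) (BrΓ-⊆ b w∈)) q) ,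
        superpose-sound (axiom-sound x₀ y₀ p₀) pairs

  realize-∨ : ∀ {Δ Γ A B G} → UniqueNames ((A ∨' B) ∷ Γ) → Δ ≋ ((A ∨' B) ∷ Γ) → Realized (A ∷ B ∷ Γ) G → Realized Δ G
  realize-∨ {Γ = Γ} {A} {B} u e (Q , cf , G≅Q) = or Γ A B (UniqueNames⇒SharingFree u) e Q , cf , G≅Q

  realize-∧ : ∀ {Δ Γ A B G} → UniqueNames ((A ∧' B) ∷ Γ) → Δ ≋ ((A ∧' B) ∷ Γ) → Correct ((A ∧' B) ∷ Γ) G →
              Realized (A ∷ Γ) (restrict (A ∷ Γ) G) → Realized (B ∷ Γ) (restrict (B ∷ Γ) G) → Realized Δ G
  realize-∧ {Γ = Γ} {A} {B} u e C (Q , cfQ , GA≅Q) (R , cfR , GB≅R) =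
    and Γ A B (UniqueNames⇒SharingFree u) e Q R , (cfQ , cfR) ,
    ≅-trans (restrict-∧-split {A} {B} {Γ} u C) (⊔-cong GA≅Q GB≅R)

  connectives : Formula → ℕ
  connectives (at _ _) = 0
  connectives (A ∨' B) = suc (connectives A + connectives B)
  connectives (A ∧' B) = suc (connectives A + connectives B)

  connectivesΓ : List Formula → ℕ
  connectivesΓ [] = 0
  connectivesΓ (F ∷ Γ) = connectives F + connectivesΓ Γ

  data Decomposition : List Formula → Set where
    atomic : ∀ {Γ} → All IsAtomic Γ → Decomposition Γ
    first-∨ : ∀ pre A B post → All IsAtomic pre → Decomposition (pre ++ (A ∨' B) ∷ post)
    first-∧ : ∀ pre A B post → All IsAtomic pre → Decomposition (pre ++ (A ∧' B) ∷ post)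

  decompose : ∀ Γ → Decomposition Γ
  decompose [] = atomic []
  decompose ((A ∨' B) ∷ Γ) = first-∨ [] A B Γ []
  decompose ((A ∧' B) ∷ Γ) = first-∧ [] A B Γ []
  decompose (at a x ∷ Γ) with decompose Γ
  ... | atomic as = atomic ((a , x , refl) ∷ as)
  ... | first-∨ pre A B post as = first-∨ (at a x ∷ pre) A B post ((a , x , refl) ∷ as)
  ... | first-∧ pre A B post as = first-∧ (at a x ∷ pre) A B post ((a , x , refl) ∷ as)

  connectivesΓ-atomic-++ : ∀ {pre} → All IsAtomic pre → ∀ Γ → connectivesΓ (pre ++ Γ) ≡ connectivesΓ Γ
  connectivesΓ-atomic-++ [] Γ = refl
  connectivesΓ-atomic-++ ((a , x , refl) ∷ as) Γ = connectivesΓ-atomic-++ as Γ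

  to-front-≋ : ∀ pre F post → (pre ++ F ∷ post) ≋ (F ∷ pre ++ post)
  to-front-≋ pre F post G = to , from
    where
    to : G ∈ pre ++ F ∷ post → G ∈ F ∷ pre ++ post
    to m with ∈-++⁻ pre m
    ... | inj₁ q = there (∈-++⁺ˡ q)
    ... | inj₂ (here e) = here e
    ... | inj₂ (there q) = there (∈-++⁺ʳ pre q)
    from : G ∈ F ∷ pre ++ post → G ∈ pre ++ F ∷ post
    from (here e) = ∈-++⁺ʳ pre (here e)
    from (there m) with ∈-++⁻ pre m
    ... | inj₁ q = ∈-++⁺ˡ q
    ... | inj₂ q = ∈-++⁺ʳ pre (there q)

  realize : ∀ n Γ {G} → connectivesΓ Γ ≤ n → UniqueNames Γ → Correct Γ G → Realized Γ G
  realize n Γ le u C with decompose Γ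
  ... | atomic as = Atomic.realize-atomic u as C
  realize zero _ le u C | first-∨ pre A B post as with subst (_≤ 0) (connectivesΓ-atomic-++ as ((A ∨' B) ∷ post)) le
  ... | ()
  realize zero _ le u C | first-∧ pre A B post as with subst (_≤ 0) (connectivesΓ-atomic-++ as ((A ∧' B) ∷ post)) le
  ... | ()
  realize (suc n) _ le u C | first-∨ pre A B post as with subst (_≤ suc n) (connectivesΓ-atomic-++ as ((A ∨' B) ∷ post)) le
  ... | s≤s le′ = realize-∨ {Γ = pre ++ post} u′ e (realize n (A ∷ B ∷ pre ++ post) le″ (subst Unique (sym (namesΓ-∨ A B (pre ++ post))) u′)
                                     (Correct-∨⁻ {A} {B} {pre ++ post} u′ (Correct-≋ e C)))
    where
    e = to-front-≋ pre (A ∨' B) post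
    u′ = UniqueNames-to-front pre (A ∨' B) post u
    le″ : connectivesΓ (A ∷ B ∷ pre ++ post) ≤ n
    le″ = ≤-trans (≤-reflexive (trans (cong (λ k → connectives A + (connectives B + k)) (connectivesΓ-atomic-++ as post))
                                       (sym (+-assoc (connectives A) (connectives B) (connectivesΓ post))))) le′
  realize (suc n) _ le u C | first-∧ pre A B post as with subst (_≤ suc n) (connectivesΓ-atomic-++ as ((A ∧' B) ∷ post)) le
  ... | s≤s le′ = realize-∧ {Γ = pre ++ post} u′ e C′
                    (realize n (A ∷ pre ++ post) leA (UniqueNames-∧ˡ {A} {B} {pre ++ post} u′) (Correct-restrict-∧ˡ {A} {B} {pre ++ post} u′ C′))
                    (realize n (B ∷ pre ++ post) leB (UniqueNames-∧ʳ {A} {B} {pre ++ post} u′) (Correct-restrict-∧ʳ {A} {B} {pre ++ post} u′ C′))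
    where
    e = to-front-≋ pre (A ∧' B) post
    u′ = UniqueNames-to-front pre (A ∧' B) post u
    C′ = Correct-≋ e C
    leA : connectivesΓ (A ∷ pre ++ post) ≤ n
    leA = ≤-trans (≤-reflexive (cong (connectives A +_) (connectivesΓ-atomic-++ as post)))
                  (≤-trans (+-mono-≤ (m≤m+n (connectives A) (connectives B)) ≤-refl) le′)
    leB : connectivesΓ (B ∷ pre ++ post) ≤ n
    leB = ≤-trans (≤-reflexive (cong (connectives B +_) (connectivesΓ-atomic-++ as post)))
                  (≤-trans (+-mono-≤ (m≤n+m (connectives B) (connectives A)) ≤-refl) le′)

  BrΓ-drop : ∀ {F Γ Y X} → Disjoint (names F) (namesΓ Γ) → BrΓ (F ∷ Γ) Y →
             X ≐ (λ z → z ∈ Y × z ∉ names F) → BrΓ Γ X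
  BrΓ-drop {F} d (s , _ ∷ al) e =
    (λ z p → let (p₁ , p₂) = proj₁ (e z) p in [ (λ q → ⊥-elim (p₂ q)) , (λ q → q) ]′ (∈-++⁻ (names F) (s z p₁))) ,
    All.tabulate (λ m → BranchAt-resp (λ z zB q → proj₂ (e z) (q , λ zF → d z zF (∈-namesΓ⁺ m zB)))
                                      (λ z _ q → proj₁ (proj₁ (e z) q)) (All.lookup al m))

  -- Everything about G ⊙_A H except that it covers all branches of Γ, which needs induction on A.
  module Composition (A : Formula) (Γ : List Formula) (G H : BLGraph) (u : UniqueNames (A ∷ Γ))
                     (CG : Correct (A ∷ Γ) G) (CH : Correct (neg A ∷ Γ) H) where

    I : List Name
    I = names A

    K : BLGraph
    K = G ⊙[ I ] H

    -- true stands for the premiss ⊢ Γ, A with graph G, false for ⊢ Γ, ¬A with graph H.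
    sequent : Bool → List Formula
    sequent true = A ∷ Γ
    sequent false = neg A ∷ Γ

    cut-formula : Bool → Formula
    cut-formula true = A
    cut-formula false = neg A

    correct : ∀ b → Correct (sequent b) (if b then G else H)
    correct true = CG
    correct false = CH

    unique : ∀ b → UniqueNames (sequent b)
    unique true = u
    unique false = UniqueNames-neg {A} {Γ} u

    A#Γ : Disjoint I (namesΓ Γ)
    A#Γ = proj₂ (proj₂ (UniqueNames-∷⁻ {A} {Γ} u))

    ∈-sequent⁻ : ∀ b {z} → z ∈ namesΓ (sequent b) → z ∈ I ⊎ z ∈ namesΓ Γ
    ∈-sequent⁻ true p = ∈-++⁻ I p
    ∈-sequent⁻ false {z} p = [ (λ q → inj₁ (subst (z ∈_) (names-neg A) q)) , inj₂ ]′ (∈-++⁻ (names (neg A)) p)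

    OccΓ-outside : ∀ b {z c} → z ∉ I → OccΓ (sequent b) z c → OccΓ Γ z c
    OccΓ-outside true z∉ (here p) = ⊥-elim (z∉ (Occ⇒∈ p))
    OccΓ-outside false z∉ (here p) = ⊥-elim (z∉ (subst (_ ∈_) (names-neg A) (Occ⇒∈ p)))
    OccΓ-outside true z∉ (there q) = q
    OccΓ-outside false z∉ (there q) = q

    OccΓ-inside : ∀ b {z c} → z ∈ I → OccΓ (sequent b) z c → Occ (cut-formula b) z c
    OccΓ-inside true z∈ (here p) = p
    OccΓ-inside false z∈ (here p) = p
    OccΓ-inside true z∈ (there q) = ⊥-elim (A#Γ _ z∈ (OccΓ⇒∈ q))
    OccΓ-inside false z∈ (there q) = ⊥-elim (A#Γ _ z∈ (OccΓ⇒∈ q))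

    OccΓ-in : ∀ b {z c} → OccΓ Γ z c → OccΓ (sequent b) z c
    OccΓ-in true q = there q
    OccΓ-in false q = there q

    vertex-of : ∀ b {z} → z ∈ namesΓ (sequent b) → V G z ⊎ V H z
    vertex-of true p = inj₁ (proj₂ (vertices CG _) p)
    vertex-of false p = inj₂ (proj₂ (vertices CH _) p)

    vertex-of-Γ : ∀ {z} → z ∈ namesΓ Γ → V G z
    vertex-of-Γ p = proj₂ (vertices CG _) (∈-++⁺ʳ I p)

    outside-vertex : ∀ {z} → V G z ⊎ V H z → z ∉ I → z ∈ namesΓ Γ
    outside-vertex (inj₁ p) z∉ = [ (λ q → ⊥-elim (z∉ q)) , (λ q → q) ]′ (∈-sequent⁻ true (proj₁ (vertices CG _) p))
    outside-vertex (inj₂ p) z∉ = [ (λ q → ⊥-elim (z∉ q)) , (λ q → q) ]′ (∈-sequent⁻ false (proj₁ (vertices CH _) p))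

    module Labelled (X : List Name) where
      open Walks G H I X public

      step-sym : ∀ {b x y} → Step b x y → Step b y x
      step-sym {b} (Y , p , e) = Y , edge-sym (correct b) p , e

      step-complementary : ∀ {b x y} → Step b x y → Complementary (sequent b) x y
      step-complementary {b} (_ , p , _) = complementary (correct b) p

      step-≢ : ∀ {b x y} → Step b x y → x ≢ y
      step-≢ {b} p = Complementary⇒≢ (unique b) (step-complementary {b} p)

      Side : Atom → Bool → Name → Set
      Side a b z = OccΓ (sequent b) z a

      side-step : ∀ {a b x y} → Step b x y → Side a b x → y ∈ I → Side a (not b) y
      side-step {a} {true} p s y∈ with step-complementary {true} p
      ... | a′ , px , py with OccΓ-functional u px s
      ... | refl = here (subst (Occ (neg A) _) (bar-involutive a) (Occ-neg⁺ (OccΓ-inside true y∈ py)))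
      side-step {a} {false} p s y∈ with step-complementary {false} p
      ... | a′ , px , py with OccΓ-functional (unique false) px s
      ... | refl = here (subst (Occ A _) (bar-involutive a) (Occ-neg⁻ (OccΓ-inside false y∈ py)))

      side-functional : ∀ {a b c v} → v ∈ I → Side a b v → Side a c v → b ≡ c
      side-functional {a} {true} {true} _ _ _ = refl
      side-functional {a} {false} {false} _ _ _ = refl
      side-functional {a} {true} {false} v∈ p q =
        ⊥-elim (bar-fixpoint-free a (sym (Occ-functional uA (OccΓ-inside true v∈ p) (Occ-neg⁻ (OccΓ-inside false v∈ q)))))
        where uA = proj₁ (UniqueNames-∷⁻ {A} {Γ} u)
      side-functional {a} {false} {true} v∈ p q =
        ⊥-elim (bar-fixpoint-free a (sym (Occ-functional uA (OccΓ-inside true v∈ q) (Occ-neg⁻ (OccΓ-inside false v∈ p)))))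
        where uA = proj₁ (UniqueNames-∷⁻ {A} {Γ} u)

      walk-end : ∀ {a b e x ms y} → Walk b e x ms y → Side a b x → All (_∈ I) ms → Side (bar a) e y
      walk-end {a} {b} ⟨ p ⟩ s _ with step-complementary {b} p
      ... | a′ , px , py with OccΓ-functional (unique b) px s
      ... | refl = py
      walk-end (p ◅ w) s (m∈ ∷ al) = walk-end w (side-step p s m∈) al

      step-vertices : ∀ {c x y} → Step c x y → (V G x ⊎ V H x) × (V G y ⊎ V H y)
      step-vertices {c} (_ , p , _) =
        let (x∈ , y∈) = ends-in-label (correct c) p ; b = label-branch (correct c) p in
        vertex-of c (BrΓ-⊆ b x∈) , vertex-of c (BrΓ-⊆ b y∈)

      walk-alt : ∀ {b e x ms y} → Walk b e x ms y → Alt G H I X (x ∷ ms ++ y ∷ []) ⊎ Alt H G I X (x ∷ ms ++ y ∷ [])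
      walk-alt {true} w = inj₁ (Walk⇒Alt w)
      walk-alt {false} w = inj₂ (Walk⇒Alt w)

      walk⇒edge : ∀ {b e x ms y} → Walk b e x ms y → x ∉ I → y ∉ I → All (_∈ I) ms →
                  (∀ z → z ∈ X → z ∈ namesΓ Γ) → E K x y X
      walk⇒edge {b} {e} {x} {ms} {y} w x∉ y∉ al X⊆ =
        x≢y , (inj₁ (vertex-of-Γ x∈Γ) , x∉) , (inj₁ (vertex-of-Γ (OccΓ⇒∈ y-occ)) , y∉) ,
        (λ z p → inj₁ (vertex-of-Γ (X⊆ z p)) , (λ z∈ → A#Γ z z∈ (X⊆ z p))) ,
        ms′ , simple , al′ , x∉ , y∉ , walk-vertices step-vertices w′ , walk-alt w′
        where
        first = proj₂ (firstStep w)
        x∈Γ : x ∈ namesΓ Γ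
        x∈Γ = [ (λ q → ⊥-elim (x∉ q)) , (λ q → q) ]′
                (∈-sequent⁻ b (BrΓ-⊆ (label-branch (correct b) (proj₁ (proj₂ first))) (proj₁ (ends-in-label (correct b) (proj₁ (proj₂ first))))))
        a = proj₁ (∈⇒OccΓ {Γ} x∈Γ)
        x-occ = proj₂ (∈⇒OccΓ {Γ} x∈Γ)
        y-occ : OccΓ Γ y (bar a)
        y-occ = OccΓ-outside e y∉ (walk-end w (OccΓ-in b x-occ) al)
        x≢y : x ≢ y
        x≢y = Complementary⇒≢ (proj₁ (proj₂ (UniqueNames-∷⁻ {A} {Γ} u))) (a , x-occ , y-occ)
        open Shortcut (Side a) side-step side-functional
        simplified = shortcut w (OccΓ-in b x-occ) al y∉ x≢y
        ms′ = proj₁ (proj₂ simplified)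
        w′ = proj₁ (proj₂ (proj₂ simplified))
        simple = proj₁ (proj₂ (proj₂ (proj₂ simplified)))
        al′ = proj₁ (proj₂ (proj₂ (proj₂ (proj₂ simplified))))

      edge⇒walk : ∀ {x y} → E K x y X →
                  Σ Bool λ b → Σ Bool λ e → Σ (List Name) λ ms → Walk b e x ms y × All (_∈ I) ms × x ∉ I × y ∉ I
      edge⇒walk (_ , _ , _ , _ , ms , _ , al , x∉ , y∉ , _ , inj₁ alt) =
        let (e , w) = Alt⇒Walk true ms alt in true , e , ms , w , al , x∉ , y∉
      edge⇒walk (_ , _ , _ , _ , ms , _ , al , x∉ , y∉ , _ , inj₂ alt) =
        let (e , w) = Alt⇒Walk false ms alt in false , e , ms , w , al , x∉ , y∉

      label⊆Γ : ∀ {x y} → E K x y X → ∀ z → z ∈ X → z ∈ namesΓ Γ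
      label⊆Γ (_ , _ , _ , W , _) z p = outside-vertex (proj₁ (W z p)) (proj₂ (W z p))

    open Labelled

    ⊙-vertices : ∀ z → V K z ⟺ (z ∈ namesΓ Γ)
    ⊙-vertices z = (λ (v , z∉) → outside-vertex v z∉) , (λ p → inj₁ (vertex-of-Γ p) , (λ q → A#Γ z q p))

    drop-cut-formula : ∀ b {Y X} → BrΓ (sequent b) Y → X ≐ (λ z → z ∈ Y × z ∉ I) → BrΓ Γ X
    drop-cut-formula true br e = BrΓ-drop A#Γ br e
    drop-cut-formula false {Y} {X} br e =
      BrΓ-drop (subst (λ N → Disjoint N (namesΓ Γ)) (sym (names-neg A)) A#Γ) br
               (subst (λ N → X ≐ (λ z → z ∈ Y × z ∉ N)) (sym (names-neg A)) e)

    ⊙-label-branch : ∀ {x y X} → E K x y X → BrΓ Γ X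
    ⊙-label-branch {X = X} p with edge⇒walk X p
    ... | b , _ , _ , w , _ with firstStep X w
    ... | _ , Y , q , e = drop-cut-formula b (label-branch (correct b) q) e

    ⊙-ends-in-label : ∀ {x y X} → E K x y X → x ∈ X × y ∈ X
    ⊙-ends-in-label {x} {y} {X} p with edge⇒walk X p
    ... | b , e , _ , w , _ , x∉ , y∉ with firstStep X w | lastStep X w
    ... | _ , Y , q , eY | _ , Y′ , q′ , eY′ =
      proj₂ (eY x) (proj₁ (ends-in-label (correct b) q) , x∉) , proj₂ (eY′ y) (proj₂ (ends-in-label (correct e) q′) , y∉)

    ⊙-complementary : ∀ {x y X} → E K x y X → Complementary Γ x y
    ⊙-complementary {x} {y} {X} p with edge⇒walk X p
    ... | b , e , ms , w , al , x∉ , y∉ = a , x-occ , OccΓ-outside e y∉ (walk-end X w (OccΓ-in b x-occ) al)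
      where
      x∈Γ = outside-vertex (proj₁ (proj₁ (proj₂ p))) (proj₂ (proj₁ (proj₂ p)))
      a = proj₁ (∈⇒OccΓ {Γ} x∈Γ)
      x-occ = proj₂ (∈⇒OccΓ {Γ} x∈Γ)

    ⊙-edge-sym : ∀ {x y X} → E K x y X → E K y x X
    ⊙-edge-sym {X = X} p with edge⇒walk X p
    ... | _ , _ , _ , w , al , x∉ , y∉ with Reverse.reverse X (step-sym X) w
    ... | _ , w′ , sub = walk⇒edge X w′ y∉ x∉ (All.tabulate (λ r → All.lookup al (sub r))) (label⊆Γ X p)

    ⊙-edge-resp : ∀ {x y X X′} → E K x y X → X ≈ X′ → E K x y X′
    ⊙-edge-resp {X′ = X′} (x≢y , Wx , Wy , WX , ms , un , al , x∉ , y∉ , vs , alt) e =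
      x≢y , Wx , Wy , (λ z p → WX z (proj₂ (e z) p)) ,
      ms , un , al , x∉ , y∉ , vs ,
      [ (λ q → inj₁ (Alt-map (EdgeI-relabel G e) (EdgeI-relabel H e) _ q))
      , (λ q → inj₂ (Alt-map (EdgeI-relabel H e) (EdgeI-relabel G e) _ q)) ]′ alt

    ⊙-edge? : ∀ x y X → Dec (E K x y X)
    ⊙-edge? x y X =
      ¬? (x ≟ y) ×-dec W? x ×-dec W? y ×-dec map′ (λ al z → All.lookup al) (λ f → All.tabulate (f _)) (all? W? X)
      ×-dec CompletePath-dec G H I X x y (step? G CG) (step? H CH) V?
      where
      V? : ∀ z → Dec (V G z ⊎ V H z)
      V? z = map′ (proj₂ (vertices CG z)) (proj₁ (vertices CG z)) (z ∈? namesΓ (A ∷ Γ))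
             ⊎-dec map′ (proj₂ (vertices CH z)) (proj₁ (vertices CH z)) (z ∈? namesΓ (neg A ∷ Γ))
      W? : ∀ z → Dec ((V G z ⊎ V H z) × z ∉ I)
      W? z = V? z ×-dec ¬? (z ∈? I)
      step? : ∀ {Δ} G′ → Correct Δ G′ → ∀ v w → Dec (EdgeI G′ I v w X)
      step? G′ C v w = EdgeI-dec G′ I X v w (edge? C v w) (edge-resp C)

    Covers : Set
    Covers = ∀ {X} → BrΓ Γ X → ∃₂ λ x y → E K x y X

    Correct-⊙ : Covers → Correct Γ K
    Correct-⊙ covers-Γ = record
      { vertices = ⊙-vertices
      ; label-branch = ⊙-label-branch
      ; ends-in-label = ⊙-ends-in-label
      ; complementary = ⊙-complementary
      ; edge-sym = ⊙-edge-sym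
      ; edge-resp = ⊙-edge-resp
      ; covers = covers-Γ
      ; edge? = ⊙-edge? }

  CutPreserves : Formula → Set₁
  CutPreserves A = ∀ Γ G H → UniqueNames (A ∷ Γ) → Correct (A ∷ Γ) G → Correct (neg A ∷ Γ) H →
                   Correct Γ (G ⊙[ names A ] H)

  BrΓ-∷-at : ∀ {c Γ X} z → z ∉ namesΓ Γ → BrΓ Γ X → BrΓ (at c z ∷ Γ) (z ∷ X)
  BrΓ-∷-at {c} {Γ} {X} z z∉ (s , al) =
    (λ { w (here refl) → here refl ; w (there p) → there (s w p) }) ,
    (z ∷ [] , (λ w → (λ { (here q) → q }) , here) , (λ w → (λ { (here refl) → here refl , here refl }) , proj₂)) ∷
    All.tabulate (λ m → BranchAt-resp (λ w _ q → there q)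
                         (λ { w wF (here refl) → ⊥-elim (z∉ (∈-namesΓ⁺ m wF)) ; w wF (there q) → q }) (All.lookup al m))

  -- A branch X of Γ extends by z to branches of both premisses; the edges covering them either avoid z,
  -- or meet at z and then compose to a path t, z, t′.
  cover-at : ∀ a z Γ G H (u : UniqueNames (at a z ∷ Γ)) (CG : Correct (at a z ∷ Γ) G)
             (CH : Correct (at (bar a) z ∷ Γ) H) → Composition.Covers (at a z) Γ G H u CG CH
  cover-at a z Γ G H u CG CH {X} b = covering
    where
    open Composition (at a z) Γ G H u CG CH
    z∉Γ : z ∉ namesΓ Γ
    z∉Γ = A#Γ z (here refl)
    X⊆ : ∀ w → w ∈ X → w ∈ namesΓ Γ
    X⊆ w = BrΓ-⊆ b
    ≢⇒∉ : ∀ {w} → w ≢ z → w ∉ z ∷ []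
    ≢⇒∉ w≢ (here e) = w≢ e
    step : ∀ {c v w} → E (if c then G else H) v w (z ∷ X) → Labelled.Step X c v w
    step {true} p = z ∷ X , p , λ t → (λ q → there q , (λ { (here refl) → z∉Γ (X⊆ z q) })) ,
                                      (λ { (here refl , t∉) → ⊥-elim (t∉ (here refl)) ; (there q , _) → q })
    step {false} p = z ∷ X , p , λ t → (λ q → there q , (λ { (here refl) → z∉Γ (X⊆ z q) })) ,
                                       (λ { (here refl , t∉) → ⊥-elim (t∉ (here refl)) ; (there q , _) → q })
    avoids-or-meets : ∀ c {v w} → E (if c then G else H) v w (z ∷ X) →
                      (v ≢ z × w ≢ z) ⊎ (∃ λ t → t ≢ z × E (if c then G else H) t z (z ∷ X))
    avoids-or-meets c {v} {w} p with v ≟ z | w ≟ z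
    ... | no v≢ | no w≢ = inj₁ (v≢ , w≢)
    ... | yes refl | no w≢ = inj₂ (w , w≢ , edge-sym (correct c) p)
    ... | no v≢ | yes refl = inj₂ (v , v≢ , p)
    ... | yes refl | yes refl = ⊥-elim (Labelled.step-≢ X {c} (step {c} p) refl)
    in-G = covers CG (BrΓ-∷-at z z∉Γ b)
    in-H = covers CH (BrΓ-∷-at z z∉Γ b)
    covering : ∃₂ λ x y → E K x y X
    covering with avoids-or-meets true (proj₂ (proj₂ in-G))
    ... | inj₁ (v≢ , w≢) = _ , _ , Labelled.walk⇒edge X (Walks.⟨ step {true} (proj₂ (proj₂ in-G)) ⟩) (≢⇒∉ v≢) (≢⇒∉ w≢) [] X⊆
    ... | inj₂ (t , t≢ , p) with avoids-or-meets false (proj₂ (proj₂ in-H))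
    ... | inj₁ (v≢ , w≢) = _ , _ , Labelled.walk⇒edge X (Walks.⟨ step {false} (proj₂ (proj₂ in-H)) ⟩) (≢⇒∉ v≢) (≢⇒∉ w≢) [] X⊆
    ... | inj₂ (t′ , t′≢ , q) =
      t , t′ , Labelled.walk⇒edge X (step {true} p Walks.◅ Walks.⟨ step {false} (edge-sym CH q) ⟩) (≢⇒∉ t≢) (≢⇒∉ t′≢) (here refl ∷ []) X⊆

  EdgeI-++ : ∀ G {I₁ I₂ u v Y X} → EdgeI G I₁ u v Y → X ≐ (λ z → z ∈ Y × z ∉ I₂) → EdgeI G (I₁ ++ I₂) u v X
  EdgeI-++ G {I₁} {I₂} (Y′ , p , e₁) e₂ = Y′ , p , λ z →
    (λ t → let (y∈ , ∉₂) = proj₁ (e₂ z) t ; (y′∈ , ∉₁) = proj₁ (e₁ z) y∈ in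
           y′∈ , λ w → [ ∉₁ , ∉₂ ]′ (∈-++⁻ I₁ w)) ,
    (λ (y′∈ , ∉) → proj₂ (e₂ z) (proj₂ (e₁ z) (y′∈ , λ w → ∉ (∈-++⁺ˡ w)) , λ w → ∉ (∈-++⁺ʳ I₁ w)))

  -- Cutting B ∨ C is simulated by cutting B and then C; the two alternating paths are merged into one
  -- alternating path through the names of B ∨ C.
  module ∨-Cover (B C : Formula) (Γ : List Formula) (G H : BLGraph) (u : UniqueNames ((B ∨' C) ∷ Γ))
                 (CG : Correct ((B ∨' C) ∷ Γ) G) (CH : Correct ((neg B ∧' neg C) ∷ Γ) H)
                 (cut-B : CutPreserves B) (cut-C : CutPreserves C) where

    nB = names B
    nC = names C
    I = nB ++ nC

    u-BC : UniqueNames (B ∷ C ∷ Γ)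
    u-BC = subst Unique (sym (namesΓ-∨ B C Γ)) u

    u-¬ : UniqueNames ((neg B ∧' neg C) ∷ Γ)
    u-¬ = UniqueNames-neg {B ∨' C} {Γ} u

    B#C : Disjoint nB nC
    B#C = ∨-disjoint {B} {C} {Γ} u
    B#Γ : Disjoint nB (namesΓ Γ)
    B#Γ z p q = proj₂ (proj₂ (UniqueNames-∷⁻ {B ∨' C} {Γ} u)) z (∈-++⁺ˡ p) q
    C#Γ : Disjoint nC (namesΓ Γ)
    C#Γ z p q = proj₂ (proj₂ (UniqueNames-∷⁻ {B ∨' C} {Γ} u)) z (∈-++⁺ʳ nB p) q

    H₁ = wk (C ∷ []) (restrict (neg B ∷ Γ) H)
    H₂ = restrict (neg C ∷ Γ) H
    K = G ⊙[ nB ] H₁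

    u-C¬B : UniqueNames ((neg B ∷ Γ) ++ C ∷ [])
    u-C¬B = UniqueNames-++-comm (C ∷ []) (neg B ∷ Γ)
              (UniqueNames-to-front (neg B ∷ []) C Γ (UniqueNames-neg {B} {C ∷ Γ} u-BC))

    correct-H₁ : Correct (neg B ∷ C ∷ Γ) H₁
    correct-H₁ = Correct-≋ reorder (Correct-wk u-C¬B (Correct-restrict-∧ˡ {neg B} {neg C} {Γ} u-¬ CH))
      where
      reorder : ((neg B ∷ Γ) ++ C ∷ []) ≋ (neg B ∷ C ∷ Γ)
      reorder F = to , from
        where
        to : F ∈ (neg B ∷ Γ) ++ C ∷ [] → F ∈ neg B ∷ C ∷ Γ
        to (here e) = here e
        to (there m) with ∈-++⁻ Γ m
        ... | inj₁ q = there (there q)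
        ... | inj₂ (here e) = there (here e)
        from : F ∈ neg B ∷ C ∷ Γ → F ∈ (neg B ∷ Γ) ++ C ∷ []
        from (here e) = here e
        from (there (here e)) = there (∈-++⁺ʳ Γ (here e))
        from (there (there q)) = there (∈-++⁺ˡ q)

    correct-K : Correct (C ∷ Γ) K
    correct-K = cut-B (C ∷ Γ) G H₁ u-BC (Correct-∨⁻ {B} {C} {Γ} u CG) correct-H₁

    u-CΓ : UniqueNames (C ∷ Γ)
    u-CΓ = proj₁ (proj₂ (UniqueNames-∷⁻ {B} {C ∷ Γ} u-BC))

    correct-H₂ : Correct (neg C ∷ Γ) H₂
    correct-H₂ = Correct-restrict-∧ʳ {neg B} {neg C} {Γ} u-¬ CH

    correct-K⊙H₂ : Correct Γ (K ⊙[ nC ] H₂)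
    correct-K⊙H₂ = cut-C Γ K H₂ u-CΓ correct-K correct-H₂

    module Outer = Composition (B ∨' C) Γ G H u CG CH
    module Inner = Composition B (C ∷ Γ) G H₁ u-BC (Correct-∨⁻ {B} {C} {Γ} u CG) correct-H₁
    module Last = Composition C Γ K H₂ u-CΓ correct-K correct-H₂

    module _ {X : List Name} where
      open Walks G H I X using (Walk; ⟨_⟩; _◅_; _◅◅_)

      H₁-step-lifts : ∀ {p q Y} → EdgeI H₁ nB p q Y → X ≐ (λ z → z ∈ Y × z ∉ nC) → EdgeI H I p q X
      H₁-step-lifts (Y′ , (X₁ , Y₁ , (r , _) , brY₁ , e₀) , e₁) e₂ = X₁ , r , λ z →
        (λ t → let (y∈ , ∉C) = proj₁ (e₂ z) t ; (y′∈ , ∉B) = proj₁ (e₁ z) y∈ in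
               [ (λ w → w , (λ v → [ ∉B , ∉C ]′ (∈-++⁻ nB v)))
               , (λ w → ⊥-elim (∉C ([ (λ q → q) , (λ ()) ]′ (∈-++⁻ nC (BrΓ-⊆ brY₁ w))))) ]′ (proj₁ (e₀ z) y′∈)) ,
        (λ (x∈ , ∉) → proj₂ (e₂ z) (proj₂ (e₁ z) (proj₂ (e₀ z) (inj₁ x∈) , (λ w → ∉ (∈-++⁺ˡ w))) , (λ w → ∉ (∈-++⁺ʳ nB w))))

      H₂-step-lifts : ∀ {p q} → EdgeI H₂ nC p q X → EdgeI H I p q X
      H₂-step-lifts (Y , (r , brY) , e₁) = Y , r , λ z →
        (λ t → let (y∈ , ∉C) = proj₁ (e₁ z) t in
               y∈ , (λ w → [ (λ v → [ (λ c → B#C z v (subst (z ∈_) (names-neg C) c)) , B#Γ z v ]′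
                                        (∈-++⁻ (names (neg C)) (BrΓ-⊆ brY y∈)))
                           , ∉C ]′ (∈-++⁻ nB w))) ,
        (λ (y∈ , ∉) → proj₂ (e₁ z) (y∈ , (λ w → ∉ (∈-++⁺ʳ nB w))))

      H₁-step-avoids-C : ∀ {p q Y} → EdgeI H₁ nB p q Y → p ∉ nC × q ∉ nC
      H₁-step-avoids-C (_ , (X₁ , _ , (r , brX₁) , _) , _) = avoid (proj₁ (ends-in-label CH r)) , avoid (proj₂ (ends-in-label CH r))
        where
        avoid : ∀ {z} → z ∈ X₁ → z ∉ nC
        avoid t c = [ (λ v → B#C _ (subst (_ ∈_) (names-neg B) v) c) , C#Γ _ c ]′ (∈-++⁻ (names (neg B)) (BrΓ-⊆ brX₁ t))

      inner-walk-lifts : ∀ {b e p ms q Y} → Walks.Walk G H₁ nB Y b e p ms q → X ≐ (λ z → z ∈ Y × z ∉ nC) →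
                         Walk b e p ms q
      inner-walk-lifts {true} Walks.⟨ r ⟩ e = ⟨ EdgeI-++ G r e ⟩
      inner-walk-lifts {false} Walks.⟨ r ⟩ e = ⟨ H₁-step-lifts r e ⟩
      inner-walk-lifts {true} (r Walks.◅ w) e = EdgeI-++ G r e ◅ inner-walk-lifts w e
      inner-walk-lifts {false} (r Walks.◅ w) e = H₁-step-lifts r e ◅ inner-walk-lifts w e

      starts-in-G : ∀ {b e p ms q Y} → Walks.Walk G H₁ nB Y b e p ms q → p ∈ nC → b ≡ true
      starts-in-G {true} w c = refl
      starts-in-G {false} Walks.⟨ r ⟩ c = ⊥-elim (proj₁ (H₁-step-avoids-C r) c)
      starts-in-G {false} (r Walks.◅ w) c = ⊥-elim (proj₁ (H₁-step-avoids-C r) c)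

      ends-in-G : ∀ {b e p ms q Y} → Walks.Walk G H₁ nB Y b e p ms q → q ∈ nC → e ≡ true
      ends-in-G {b} {true} w c = refl
      ends-in-G {b} {false} Walks.⟨ r ⟩ c = ⊥-elim (proj₂ (H₁-step-avoids-C r) c)
      ends-in-G {b} {false} (r Walks.◅ w) c = ends-in-G w c

      -- The side conditions make consecutive pieces alternate when they are concatenated at a name of C.
      Expanded : Name → Name → Set
      Expanded p q = Σ Bool λ b → Σ Bool λ e → Σ (List Name) λ ms →
        Walk b e p ms q × All (_∈ I) ms × (p ∈ nC → b ≡ true) × (q ∈ nC → e ≡ true)

      expand : ∀ {p q} → EdgeI K nC p q X → Expanded p q
      expand (Y , pK , eX) with Inner.Labelled.edge⇒walk Y pK
      ... | c , f , ms , w , al , _ , _ =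
        c , f , ms , inner-walk-lifts w eX , All.tabulate (λ t → ∈-++⁺ˡ (All.lookup al t)) , starts-in-G w , ends-in-G w

      Merged : Bool → Bool → Name → Name → Set
      Merged b e p q = Σ Bool λ b′ → Σ Bool λ e′ → Σ (List Name) λ ms →
        Walk b′ e′ p ms q × All (_∈ I) ms ×
        (b ≡ false → b′ ≡ false) × (b ≡ true → p ∈ nC → b′ ≡ true) ×
        (e ≡ false → e′ ≡ false) × (e ≡ true → q ∈ nC → e′ ≡ true)

      merge : ∀ {b e p ms q} → Walks.Walk K H₂ nC X b e p ms q → All (_∈ nC) ms → Merged b e p q
      merge {true} Walks.⟨ pK ⟩ [] with expand pK
      ... | c , f , ms , w , al , s , t = c , f , ms , w , al , (λ ()) , (λ _ → s) , (λ ()) , (λ _ → t)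
      merge {false} Walks.⟨ pH ⟩ [] =
        false , false , [] , ⟨ H₂-step-lifts pH ⟩ , [] , (λ _ → refl) , (λ ()) , (λ _ → refl) , (λ ())
      merge {true} (pK Walks.◅ w) (m∈ ∷ al) with expand pK | merge w al
      ... | c , f , ms , w₁ , al₁ , s , t | _ , e″ , ms″ , w″ , al″ , starts-H , _ , se , te
        with t m∈ | starts-H refl
      ... | refl | refl = c , e″ , ms ++ _ ∷ ms″ , w₁ ◅◅ w″ , All.tabulate inside , (λ ()) , (λ _ → s) , se , te
        where
        inside : ∀ {z} → z ∈ ms ++ _ ∷ ms″ → z ∈ I
        inside t with ∈-++⁻ ms t
        ... | inj₁ v = All.lookup al₁ v
        ... | inj₂ (here refl) = ∈-++⁺ʳ nB m∈
        ... | inj₂ (there v) = All.lookup al″ v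
      merge {false} (pH Walks.◅ w) (m∈ ∷ al) with merge w al
      ... | _ , e″ , ms″ , w″ , al″ , _ , starts-G , se , te with starts-G refl m∈
      ... | refl = false , e″ , _ ∷ ms″ , H₂-step-lifts pH ◅ w″ , ∈-++⁺ʳ nB m∈ ∷ al″ , (λ _ → refl) , (λ ()) , se , te

    covers-∨ : Outer.Covers
    covers-∨ {X} b with covers correct-K⊙H₂ b
    ... | x , y , p with Last.Labelled.edge⇒walk X p
    ... | _ , _ , _ , w , al , _ , _ with merge w al
    ... | _ , _ , _ , w′ , al′ , _ =
      x , y , Outer.Labelled.walk⇒edge X w′ (outside (proj₁ (ends-in-label correct-K⊙H₂ p)))
                                            (outside (proj₂ (ends-in-label correct-K⊙H₂ p))) al′ (λ z → BrΓ-⊆ b)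
      where
      outside : ∀ {z} → z ∈ X → z ∉ I
      outside t v = Outer.A#Γ _ v (BrΓ-⊆ b t)

  ⊙-swap : ∀ G H I → (G ⊙[ I ] H) ≅ (H ⊙[ I ] G)
  ⊙-swap G H I = (λ z → (λ (v , n) → swap v , n) , (λ (v , n) → swap v , n)) ,
                 (λ x y X → swap-edge G H , swap-edge H G)
    where
    swap : ∀ {P Q : Set} → P ⊎ Q → Q ⊎ P
    swap = [ inj₂ , inj₁ ]′
    swap-edge : ∀ G H {x y X} → E (G ⊙[ I ] H) x y X → E (H ⊙[ I ] G) x y X
    swap-edge G H (x≢y , (vx , x∉) , (vy , y∉) , W , ms , un , al , x∉′ , y∉′ , vs , alt) =
      x≢y , (swap vx , x∉) , (swap vy , y∉) , (λ z p → let (v , n) = W z p in swap v , n) ,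
      ms , un , al , x∉′ , y∉′ , All.map swap vs , swap alt

  -- Cut is symmetric in the two premisses, so the case ¬A reduces to the case A.
  CutPreserves-neg : ∀ B → CutPreserves B → CutPreserves (neg B)
  CutPreserves-neg B cut-B Γ G H u CG CH =
    subst (λ N → Correct Γ (G ⊙[ N ] H)) (sym (names-neg B))
      (Correct-≅ (⊙-swap H G (names B))
        (cut-B Γ H G (subst (λ N → Unique (N ++ namesΓ Γ)) (names-neg B) u)
                     (subst (λ F → Correct (F ∷ Γ) H) (neg-involutive B) CH) CG))

  cover-∧ : ∀ B C Γ G H (u : UniqueNames ((B ∧' C) ∷ Γ)) (CG : Correct ((B ∧' C) ∷ Γ) G)
            (CH : Correct ((neg B ∨' neg C) ∷ Γ) H) → CutPreserves B → CutPreserves C →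
            Composition.Covers (B ∧' C) Γ G H u CG CH
  cover-∧ B C Γ G H u CG CH cut-B cut-C {X} b =
    let (x , y , p) = covering in
    x , y , proj₁ (proj₂ (⊙-swap H G (names B ++ names C)) x y X)
                  (subst (λ N → E (H ⊙[ N ] G) x y X) (cong₂ _++_ (names-neg B) (names-neg C)) p)
    where
    covering = ∨-Cover.covers-∨ (neg B) (neg C) Γ H G (UniqueNames-neg {B ∧' C} {Γ} u) CH
                 (subst (λ F → Correct (F ∷ Γ) G) (sym (cong₂ _∧'_ (neg-involutive B) (neg-involutive C))) CG)
                 (CutPreserves-neg B cut-B) (CutPreserves-neg C cut-C) b

  mutual
    cut-preserves : ∀ A → CutPreserves A
    cut-preserves A Γ G H u CG CH = Composition.Correct-⊙ A Γ G H u CG CH (cover A Γ G H u CG CH)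

    cover : ∀ A Γ G H u CG CH → Composition.Covers A Γ G H u CG CH
    cover (at a z) = cover-at a z
    cover (B ∨' C) Γ G H u CG CH = ∨-Cover.covers-∨ B C Γ G H u CG CH (cut-preserves B) (cut-preserves C)
    cover (B ∧' C) Γ G H u CG CH = cover-∧ B C Γ G H u CG CH (cut-preserves B) (cut-preserves C)

  ≋-refl : ∀ {Γ} → Γ ≋ Γ
  ≋-refl A = (λ p → p) , (λ p → p)

  -- A name shared by A and some F ∈ Γ would force A ≡ F by the first premiss and ¬A ≡ F by the second.
  UniqueNames-cut : ∀ {A Γ L₁ L₂} → UniqueNames Γ → UniqueNames L₁ → (A ∷ Γ) ≋ L₁ →
                    UniqueNames L₂ → (neg A ∷ Γ) ≋ L₂ → UniqueNames (A ∷ Γ)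
  UniqueNames-cut {A} {Γ} uΓ u₁ e₁ u₂ e₂ = UniqueNames-∷⁺ {A} {Γ} uA uΓ A#Γ
    where
    A∈L₁ = proj₁ (e₁ A) (here refl)
    uA : SharingFreeF A
    uA = All.lookup (proj₁ (UniqueNames⇒SharingFree u₁)) A∈L₁
    A#Γ : Disjoint (names A) (namesΓ Γ)
    A#Γ z p q with ∈-namesΓ⁻ Γ q
    ... | F , m , r with UniqueNames-shared u₁ A∈L₁ (proj₁ (e₁ F) (there m)) p r
    ... | refl = neg≢ A (UniqueNames-shared u₂ (proj₁ (e₂ (neg A)) (here refl)) (proj₁ (e₂ A) (there m))
                                            (subst (z ∈_) (sym (names-neg A)) p) p)

  correct-graph : ∀ {Δ} (P : Deriv Δ) → Σ (List Formula) λ L → UniqueNames L × Δ ≋ L × Correct L ⟪ P ⟫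
  correct-graph (ax Γ A B eq sf e) =
    _ , u , e , Correct-wk {A ∷ neg B ∷ []} {Γ} u (proj₁ (Correct-id A B eq (proj₁ (UniqueNames-++⁻ (A ∷ neg B ∷ []) Γ u))))
    where u = SharingFree⇒UniqueNames sf
  correct-graph (cut {Γ} A sf Q R) with correct-graph Q | correct-graph R
  ... | L₁ , u₁ , e₁ , C₁ | L₂ , u₂ , e₂ , C₂ =
    Γ , u , ≋-refl , cut-preserves A Γ ⟪ Q ⟫ ⟪ R ⟫ (UniqueNames-cut u u₁ e₁ u₂ e₂) (Correct-≋ (≋-sym e₁) C₁) (Correct-≋ (≋-sym e₂) C₂)
    where u = SharingFree⇒UniqueNames sf
  correct-graph (sup {Γ} sf P Q) with correct-graph P | correct-graph Q
  ... | _ , _ , e₁ , C₁ | _ , _ , e₂ , C₂ =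
    Γ , SharingFree⇒UniqueNames sf , ≋-refl , Correct-⊔ (Correct-≋ (≋-sym e₁) C₁) (Correct-≋ (≋-sym e₂) C₂)
  correct-graph (or Γ A B sf e P) with correct-graph P
  ... | _ , _ , e₁ , C₁ = _ , u , e , Correct-∨⁺ {A} {B} {Γ} u (Correct-≋ (≋-sym e₁) C₁)
    where u = SharingFree⇒UniqueNames sf
  correct-graph (and Γ A B sf e P Q) with correct-graph P | correct-graph Q
  ... | _ , _ , e₁ , C₁ | _ , _ , e₂ , C₂ = _ , u , e , Correct-∧ {A} {B} {Γ} u (Correct-≋ (≋-sym e₁) C₁) (Correct-≋ (≋-sym e₂) C₂)
    where u = SharingFree⇒UniqueNames sf

  cut-elimination : ∀ {Δ} (P : Deriv Δ) → Σ (Deriv Δ) λ Q → CutFree Q × (⟪ P ⟫ ≅ ⟪ Q ⟫)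
  cut-elimination P@(ax _ _ _ _ _ _) = P , tt , ≅-refl
  cut-elimination P@(cut {Γ} A sf _ _) with correct-graph P
  ... | _ , _ , e , C = realize _ Γ ≤-refl (SharingFree⇒UniqueNames sf) (Correct-≋ (≋-sym e) C)
  cut-elimination (sup sf P Q) with cut-elimination P | cut-elimination Q
  ... | P′ , cf₁ , P≅ | Q′ , cf₂ , Q≅ = sup sf P′ Q′ , (cf₁ , cf₂) , ⊔-cong P≅ Q≅
  cut-elimination (or Γ A B sf e P) with cut-elimination P
  ... | P′ , cf , P≅ = or Γ A B sf e P′ , cf , P≅
  cut-elimination (and Γ A B sf e P Q) with cut-elimination P | cut-elimination Q
  ... | P′ , cf₁ , P≅ | Q′ , cf₂ , Q≅ = and Γ A B sf e P′ Q′ , (cf₁ , cf₂) , ⊔-cong P≅ Q≅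

theorem3 : (Atom : Set) (bar : Atom → Atom) →
           (∀ a → bar (bar a) ≡ a) → (∀ a → bar a ≢ a) →
           let open GS4 Atom bar in
           (Δ : List Formula) (P : Deriv Δ) →
           Σ (Deriv Δ) (λ Q → CutFree Q × (⟪ P ⟫ ≅ ⟪ Q ⟫))
theorem3 Atom bar bar-involutive bar-fixpoint-free Δ = cut-elimination Atom bar bar-involutive bar-fixpoint-free
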